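{- Under the standing assumptions below, let $B$ be a block of $\mathcal D$ and set $p^{t}=|T_{B}|$. Then $G_{B}/T_{B}$ is isomorphic to a subgroup of $G_{0}$ of index $\frac{2p^{t}(p^{d}-1)}{k(k-1)}$ containing an isomorphic copy of $G_{0,B}$.
   Context: Standing assumptions: $\mathcal{D}=(\mathcal P,\mathcal B)$ is a non-trivial $2$-$(v,k,2)$ design (any two distinct points lie in exactly $2$ blocks, blocks have size $k$, $2<k<v$), with replication number $r$ (number of blocks through a point). $G\le \mathrm{Aut}(\mathcal D)$ is flag-transitive (transitive on incident point–block pairs) and point-primitive, and the socle $T$ of $G$ is an elementary abelian $p$-group ($p$ prime) acting regularly on points. Thus $\mathcal P$ is identified with $V=V_d(p)=GF(p)^d$, $T$ is the translation group of $V$, $v=p^d$, and $G=T:G_0\le AGL_d(p)$, where $G_0$ is the stabilizer of the zero vector and acts irreducibly on $V$. Moreover $r$ is assumed to be even. For a block $B$, $G_B$, $T_B=T\cap G_B$ and $G_{0,B}=G_0\cap G_B$ denote the setwise stabilizers of $B$. -}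

module Defs where

open import Data.Nat using (ℕ; zero; suc; _+_; _*_; NonZero)
open import Data.Nat.DivMod using (_mod_)
open import Data.Fin using (Fin; toℕ) renaming (_≟_ to _≟F_)

open import Data.Bool using (Bool; true; false; if_then_else_; _∧_) renaming (_≟_ to _≟B_)
open import Data.Product using (Σ; _×_; _,_; proj₁; proj₂; ∃-syntax)
open import Data.Sum using (_⊎_)
open import Data.List using (List; []; _∷_; allFin; map; concatMap; filterᵇ; length; cartesianProduct)
open import Data.Bool.ListAction using (all; any)
open import Data.Vec using (Vec; []; _∷_; zipWith; foldr′; replicate; tabulate; transpose)
  renaming (map to vmap)
import Data.Vec.Properties as VP
import Data.Product.Properties as PP
open import Relation.Nullary using (does; ¬_)
open import Relation.Binary using (DecidableEquality; IsEquivalence)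
open import Relation.Binary.PropositionalEquality using (_≡_)

module _ (p : ℕ) .{{nz : NonZero p}} (d : ℕ) where

  -- The prime field GF(p), realised as Fin p with arithmetic mod p.
  Fp : Set
  Fp = Fin p

  _+F_ : Fp → Fp → Fp
  a +F b = (toℕ a + toℕ b) mod p

  _*F_ : Fp → Fp → Fp
  a *F b = (toℕ a * toℕ b) mod p

  0F 1F : Fp
  0F = 0 mod p
  1F = 1 mod p

  -- V = GF(p)^d (the point set), and d×d matrices (lists of rows).
  V : Set
  V = Vec Fp d

  Mat : Set
  Mat = Vec V d

  _≟V_ : DecidableEquality V
  _≟V_ = VP.≡-dec _≟F_

  _≟M_ : DecidableEquality Mat
  _≟M_ = VP.≡-dec _≟V_

  _+V_ : V → V → V
  _+V_ = zipWith _+F_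

  zeroV : V
  zeroV = replicate d 0F

  dot : V → V → Fp
  dot u w = foldr′ _+F_ 0F (zipWith _*F_ u w)

  _·V_ : Mat → V → V
  M ·V x = vmap (λ row → dot row x) M

  _·M_ : Mat → Mat → Mat
  M ·M N = vmap (λ row → vmap (dot row) (transpose N)) M

  idM : Mat
  idM = tabulate (λ i → tabulate (λ j → if does (i ≟F j) then 1F else 0F))

  -- Elements of AGL_d(p) (and candidates): x ↦ A x + b is the pair (A , b).
  Aff : Set
  Aff = Mat × V

  _≟A_ : DecidableEquality Aff
  _≟A_ = PP.≡-dec _≟M_ _≟V_

  apply : Aff → V → V
  apply (A , b) x = (A ·V x) +V b

  compose : Aff → Aff → Aff
  compose (A , b) (A' , b') = (A ·M A' , (A ·V b') +V b)

  idAff : Aff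
  idAff = (idM , zeroV)

  Invertible : Mat → Set
  Invertible A = ∃[ A' ] ((A ·M A' ≡ idM) × (A' ·M A ≡ idM))

  isTransl : Aff → Bool
  isTransl g = does (proj₁ g ≟M idM)

  fixesZero : Aff → Bool
  fixesZero g = does (proj₂ g ≟V zeroV)

  allVecs : {A : Set} → List A → (n : ℕ) → List (Vec A n)
  allVecs L zero = [] ∷ []
  allVecs L (suc n) = concatMap (λ a → map (a ∷_) (allVecs L n)) L

  allV : List V
  allV = allVecs (allFin p) d

  allAff : List Aff
  allAff = cartesianProduct (allVecs allV d) allV

  count : {A : Set} → (A → Bool) → List A → ℕ
  count P L = length (filterᵇ P L)

  Subset : Set
  Subset = V → Bool

  upd : Subset → V → Bool → Subset
  upd f x b y = if does (y ≟V x) then b else f y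

  subsetsOf : List V → List Subset
  subsetsOf [] = (λ _ → false) ∷ []
  subsetsOf (x ∷ xs) = concatMap (λ f → upd f x true ∷ upd f x false ∷ []) (subsetsOf xs)

  allSubsets : List Subset
  allSubsets = subsetsOf allV

  size : Subset → ℕ
  size B = count B allV

  img : Aff → Subset → Subset
  img g B y = any (λ x → B x ∧ does (apply g x ≟V y)) allV

  -- g ∈ G_B  (setwise stabiliser: x ∈ B ⟺ g x ∈ B, for g a permutation of V)
  stabilises : Subset → Aff → Bool
  stabilises B g = all (λ x → does (B (apply g x) ≟B B x)) allV

  -- A 2-(v,k,2) design on the point set V; blocks form a set of subsets
  -- (isBlock is required to respect extensional equality of subsets).
  record Design2 (k : ℕ) : Set where
    field
      isBlock     : Subset → Bool
      isBlock-ext : ∀ B C → (∀ x → B x ≡ C x) → isBlock B ≡ isBlock C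
      blockSize   : ∀ B → isBlock B ≡ true → size B ≡ k
      λ≡2         : ∀ x y → ¬ (x ≡ y) →
                    count (λ B → isBlock B ∧ (B x ∧ B y)) allSubsets ≡ 2

    rep : ℕ
    rep = count (λ B → isBlock B ∧ B zeroV) allSubsets

  -- A subgroup of AGL_d(p), given by a membership predicate on Aff.
  -- (A nonempty subset of a finite group closed under products is a subgroup.)
  record AffSubgroup (mem : Aff → Bool) : Set where
    field
      mem-inv  : ∀ g → mem g ≡ true → Invertible (proj₁ g)
      mem-id   : mem idAff ≡ true
      mem-comp : ∀ g h → mem g ≡ true → mem h ≡ true → mem (compose g h) ≡ true

  ContainsT : (Aff → Bool) → Set
  ContainsT mem = ∀ b → mem (idM , b) ≡ true

  IsPointPrimitive : (Aff → Bool) → Set₁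
  IsPointPrimitive mem =
    (∀ x y → ∃[ g ] (mem g ≡ true × apply g x ≡ y)) ×
    (∀ (R : V → V → Set) → IsEquivalence R →
       (∀ g → mem g ≡ true → ∀ x y → R x y → R (apply g x) (apply g y)) →
       (∀ x y → R x y) ⊎ (∀ x y → R x y → x ≡ y))

  module _ {k : ℕ} (D : Design2 k) (mem : Aff → Bool) where
    open Design2 D

    IsAutGroup : Set
    IsAutGroup = ∀ g → mem g ≡ true → ∀ B → isBlock B ≡ true → isBlock (img g B) ≡ true

    IsFlagTransitive : Set
    IsFlagTransitive = ∀ x y B C → isBlock B ≡ true → B x ≡ true →
      isBlock C ≡ true → C y ≡ true →
      ∃[ g ] (mem g ≡ true × apply g x ≡ y × (∀ z → img g B z ≡ C z))

  G₀ : (Aff → Bool) → Aff → Bool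
  G₀ mem g = mem g ∧ fixesZero g

  G[_] : (Aff → Bool) → Subset → Aff → Bool
  G[ mem ] B g = mem g ∧ stabilises B g

  T[_] : (Aff → Bool) → Subset → Aff → Bool
  T[ mem ] B g = mem g ∧ (isTransl g ∧ stabilises B g)

  G₀[_] : (Aff → Bool) → Subset → Aff → Bool
  G₀[ mem ] B g = mem g ∧ (fixesZero g ∧ stabilises B g)

  IsSubgroupOf : (Aff → Bool) → (Aff → Bool) → Set
  IsSubgroupOf H K = (∀ g → H g ≡ true → K g ≡ true) × AffSubgroup H

  IsHomInto : (Aff → Bool) → (Aff → Bool) → (Aff → Aff) → Set
  IsHomInto A B φ =
    (∀ g → A g ≡ true → B (φ g) ≡ true) ×
    (∀ g h → A g ≡ true → A h ≡ true → φ (compose g h) ≡ compose (φ g) (φ h))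

  -- A / N ≅ B, witnessed (first isomorphism theorem) by a surjective homomorphism
  -- A → B whose kernel is exactly N.
  QuotientIso : (A N B : Aff → Bool) → Set
  QuotientIso A N B = ∃[ φ ] (IsHomInto A B φ ×
    (∀ h → B h ≡ true → ∃[ g ] (A g ≡ true × φ g ≡ h)) ×
    (∀ g → A g ≡ true → (φ g ≡ idAff → N g ≡ true) × (N g ≡ true → φ g ≡ idAff)))

  Embeds : (A B : Aff → Bool) → Set
  Embeds A B = ∃[ ψ ] (IsHomInto A B ψ ×
    (∀ g h → A g ≡ true → A h ≡ true → ψ g ≡ ψ h → g ≡ h))

{-# OPTIONS --safe #-}
module Submission where

-- Because G contains the translation group T,
-- whether (A , b) lies in G depends only on A, so |G| = p^d |G₀|. Sending (A , b) to (A , 0)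
-- is a homomorphism from G_B onto the group H of linear parts of G_B; its kernel is T_B, each
-- fibre is a coset of T_B, H lies in G₀ and contains G_{0,B}, and |G_B| = |T_B| |H|. Finally
-- count the triples (g , x , y) with g ∈ G and x ≠ y points of the block gB: each g contributes
-- k(k-1), while flag-transitivity makes exactly |G_B| elements of G carry B onto any given block,
-- so each of the v(v-1) pairs is covered 2|G_B| times (λ = 2). Hence |G| k(k-1) = v(v-1) 2|G_B|,
-- and cancelling v gives |G₀| k(k-1) = 2 |T_B| (v-1) |H|.

open import Data.Nat using (ℕ; NonZero)

module Counting where

  open import Data.Bool using (Bool; true; false; not; _∧_)
  open import Data.Bool.ListAction using (any; all)
  open import Data.Fin using (zero; suc) renaming (_≟_ to _≟ᶠ_)
  open import Data.List using (List; []; _∷_; _++_; map; concatMap; filterᵇ; length; cartesianProduct; allFin)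
  import Data.List.Properties as Listₚ
  open import Data.List.Membership.Propositional using (_∈_)
  import Data.List.Relation.Unary.All as All
  open import Data.List.Relation.Unary.AllPairs using ([]; _∷_)
  open import Data.List.Relation.Unary.Any using (here; there)
  open import Data.List.Relation.Unary.Unique.Propositional using (Unique)
  open import Data.Nat using (zero; suc; _+_; _*_; _≤_; _<_; z≤n; s≤s)
  open import Data.Nat.Properties
  open import Algebra.Properties.CommutativeSemigroup +-commutativeSemigroup
    using () renaming (interchange to +-interchange)
  open import Data.Product using (_×_; _,_; proj₁; proj₂; ∃-syntax)
  open import Data.Product.Properties using () renaming (≡-dec to ×-≡-dec)
  open import Data.Vec using (Vec; []; _∷_)
  import Data.Vec.Properties as Vecₚ
  open import Function using (_∘_; id)
  open import Relation.Binary using (DecidableEquality)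
  open import Relation.Binary.PropositionalEquality
  open import Relation.Nullary using (Dec; does; yes; no; contradiction)
  open import Relation.Nullary.Decidable using (dec-true)

  private
    variable
      A B : Set

  ⟦_⟧ : Bool → ℕ
  ⟦ true ⟧ = 1
  ⟦ false ⟧ = 0

  ⟦∧⟧ : ∀ a b → ⟦ a ∧ b ⟧ ≡ ⟦ a ⟧ * ⟦ b ⟧
  ⟦∧⟧ true b = sym (+-identityʳ ⟦ b ⟧)
  ⟦∧⟧ false b = refl

  ⟦⟧+⟦not⟧ : ∀ a → ⟦ a ⟧ + ⟦ not a ⟧ ≡ 1
  ⟦⟧+⟦not⟧ true = refl
  ⟦⟧+⟦not⟧ false = refl

  does≡true⇒ : ∀ {P : Set} (P? : Dec P) → does P? ≡ true → P
  does≡true⇒ (yes p) _ = p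

  ∧-true⁻ : ∀ {a b} → a ∧ b ≡ true → a ≡ true × b ≡ true
  ∧-true⁻ {true} h = refl , h

  ∧-true⁺ : ∀ {a b} → a ≡ true → b ≡ true → a ∧ b ≡ true
  ∧-true⁺ refl refl = refl

  true⇔true⇒≡ : ∀ {a b} → (a ≡ true → b ≡ true) → (b ≡ true → a ≡ true) → a ≡ b
  true⇔true⇒≡ {true} {true} _ _ = refl
  true⇔true⇒≡ {true} {false} f _ = sym (f refl)
  true⇔true⇒≡ {false} {true} _ g = g refl
  true⇔true⇒≡ {false} {false} _ _ = refl

  ⟦⟧-mono : ∀ {a b} → (a ≡ true → b ≡ true) → ⟦ a ⟧ ≤ ⟦ b ⟧
  ⟦⟧-mono {false} _ = z≤n
  ⟦⟧-mono {true} f rewrite f refl = s≤s z≤n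

  ∑ : List A → (A → ℕ) → ℕ
  ∑ [] f = 0
  ∑ (x ∷ xs) f = f x + ∑ xs f

  syntax ∑ L (λ x → e) = ∑[ x ∈ L ] e

  length-filterᵇ : (P : A → Bool) (L : List A) → length (filterᵇ P L) ≡ ∑[ x ∈ L ] ⟦ P x ⟧
  length-filterᵇ P [] = refl
  length-filterᵇ P (x ∷ xs) with P x
  ... | true = cong suc (length-filterᵇ P xs)
  ... | false = length-filterᵇ P xs

  length≡∑1 : (L : List A) → length L ≡ ∑[ x ∈ L ] 1
  length≡∑1 [] = refl
  length≡∑1 (x ∷ L) = cong suc (length≡∑1 L)

  ∑-cong : (L : List A) {f g : A → ℕ} → (∀ x → f x ≡ g x) → ∑ L f ≡ ∑ L g
  ∑-cong [] e = refl
  ∑-cong (x ∷ L) e = cong₂ _+_ (e x) (∑-cong L e)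

  ∑-distrib-+ : (L : List A) (f g : A → ℕ) → ∑[ x ∈ L ] (f x + g x) ≡ ∑ L f + ∑ L g
  ∑-distrib-+ [] f g = refl
  ∑-distrib-+ (x ∷ L) f g =
    trans (cong (f x + g x +_) (∑-distrib-+ L f g)) (+-interchange (f x) (g x) (∑ L f) (∑ L g))

  *-distribˡ-∑ : (L : List A) (c : ℕ) (f : A → ℕ) → c * ∑ L f ≡ ∑[ x ∈ L ] (c * f x)
  *-distribˡ-∑ [] c f = *-zeroʳ c
  *-distribˡ-∑ (x ∷ L) c f =
    trans (*-distribˡ-+ c (f x) (∑ L f)) (cong (c * f x +_) (*-distribˡ-∑ L c f))

  *-distribʳ-∑ : (L : List A) (c : ℕ) (f : A → ℕ) → ∑ L f * c ≡ ∑[ x ∈ L ] (f x * c)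
  *-distribʳ-∑ L c f =
    trans (*-comm (∑ L f) c) (trans (*-distribˡ-∑ L c f) (∑-cong L (λ x → *-comm c (f x))))

  ∑-zero : (L : List A) {f : A → ℕ} → (∀ x → f x ≡ 0) → ∑ L f ≡ 0
  ∑-zero [] e = refl
  ∑-zero (x ∷ L) e = cong₂ _+_ (e x) (∑-zero L e)

  ∑-const : (L : List A) (c : ℕ) → ∑[ x ∈ L ] c ≡ length L * c
  ∑-const [] c = refl
  ∑-const (x ∷ L) c = cong (c +_) (∑-const L c)

  ∑-mono-≤ : (L : List A) {f g : A → ℕ} → (∀ x → f x ≤ g x) → ∑ L f ≤ ∑ L g
  ∑-mono-≤ [] e = z≤n
  ∑-mono-≤ (x ∷ L) e = +-mono-≤ (e x) (∑-mono-≤ L e)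

  ∑-++ : (L M : List A) (f : A → ℕ) → ∑ (L ++ M) f ≡ ∑ L f + ∑ M f
  ∑-++ [] M f = refl
  ∑-++ (x ∷ L) M f = trans (cong (f x +_) (∑-++ L M f)) (sym (+-assoc (f x) _ _))

  ∑-positive : (L : List A) (f : A → ℕ) → 0 < ∑ L f → ∃[ x ] 0 < f x
  ∑-positive (x ∷ L) f h with f x in eq
  ... | zero = ∑-positive L f h
  ... | suc _ = x , subst (0 <_) (sym eq) (s≤s z≤n)

  ∑-map : (L : List A) (g : A → B) (f : B → ℕ) → ∑ (map g L) f ≡ ∑ L (f ∘ g)
  ∑-map [] g f = refl
  ∑-map (x ∷ L) g f = cong (f (g x) +_) (∑-map L g f)

  ∑-concatMap : (L : List A) (g : A → List B) (f : B → ℕ) →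
                ∑ (concatMap g L) f ≡ ∑[ x ∈ L ] ∑ (g x) f
  ∑-concatMap [] g f = refl
  ∑-concatMap (x ∷ L) g f = trans (∑-++ (g x) (concatMap g L) f) (cong (∑ (g x) f +_) (∑-concatMap L g f))

  ∑-cartesianProduct : (L : List A) (M : List B) (f : A × B → ℕ) →
                       ∑ (cartesianProduct L M) f ≡ ∑[ x ∈ L ] ∑[ y ∈ M ] f (x , y)
  ∑-cartesianProduct [] M f = refl
  ∑-cartesianProduct (x ∷ L) M f =
    trans (∑-++ (map (x ,_) M) _ f) (cong₂ _+_ (∑-map M (x ,_) f) (∑-cartesianProduct L M f))

  ∑-comm : (L : List A) (M : List B) (f : A → B → ℕ) →
           ∑[ x ∈ L ] ∑[ y ∈ M ] f x y ≡ ∑[ y ∈ M ] ∑[ x ∈ L ] f x y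
  ∑-comm [] M f = sym (∑-zero M (λ _ → refl))
  ∑-comm (x ∷ L) M f =
    trans (cong (∑ M (f x) +_) (∑-comm L M f)) (sym (∑-distrib-+ M (f x) (λ y → ∑[ x′ ∈ L ] f x′ y)))

  ∑-partition : (L : List A) (M : List B) (class : A → B → Bool) →
                (∀ x → ∑[ y ∈ M ] ⟦ class x y ⟧ ≡ 1) → (f : A → ℕ) →
                ∑ L f ≡ ∑[ y ∈ M ] ∑[ x ∈ L ] (⟦ class x y ⟧ * f x)
  ∑-partition L M class unique f = begin
    ∑ L f
      ≡⟨ ∑-cong L (λ x → sym (trans (cong (_* f x) (unique x)) (*-identityˡ (f x)))) ⟩
    ∑[ x ∈ L ] (∑[ y ∈ M ] ⟦ class x y ⟧ * f x)
      ≡⟨ ∑-cong L (λ x → *-distribʳ-∑ M (f x) _) ⟩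
    ∑[ x ∈ L ] ∑[ y ∈ M ] (⟦ class x y ⟧ * f x)
      ≡⟨ ∑-comm L M _ ⟩
    ∑[ y ∈ M ] ∑[ x ∈ L ] (⟦ class x y ⟧ * f x) ∎
    where open ≡-Reasoning

  module Enumeration {A : Set} (_≟_ : DecidableEquality A) where

    multiplicity : A → List A → ℕ
    multiplicity x L = ∑[ y ∈ L ] ⟦ does (y ≟ x) ⟧

    record Enumerates (L : List A) : Set where
      field occursOnce : ∀ x → multiplicity x L ≡ 1

    open Enumerates public

    multiplicity>0⇒∈ : ∀ {x} L → 0 < multiplicity x L → x ∈ L
    multiplicity>0⇒∈ {x} (y ∷ L) h with y ≟ x
    ... | yes refl = here refl
    ... | no _ = there (multiplicity>0⇒∈ L h)

    enumerates⇒∈ : ∀ {L} → Enumerates L → ∀ x → x ∈ L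
    enumerates⇒∈ {L} en x = multiplicity>0⇒∈ L (subst (0 <_) (sym (occursOnce en x)) (s≤s z≤n))

    ∈⇒multiplicity>0 : ∀ {x L} → x ∈ L → 0 < multiplicity x L
    ∈⇒multiplicity>0 {x} (here refl) rewrite dec-true (x ≟ x) refl = s≤s z≤n
    ∈⇒multiplicity>0 {x} (there {x = y} x∈L) = ≤-trans (∈⇒multiplicity>0 x∈L) (m≤n+m _ ⟦ does (y ≟ x) ⟧)

    multiplicity≤1⇒unique : ∀ L → (∀ x → multiplicity x L ≤ 1) → Unique L
    multiplicity≤1⇒unique [] _ = []
    multiplicity≤1⇒unique (x ∷ L) ≤1 =
      All.tabulate x∉L ∷ multiplicity≤1⇒unique L (λ z → ≤-trans (m≤n+m _ _) (≤1 z))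
      where
      x∉L : ∀ {y} → y ∈ L → x ≢ y
      x∉L y∈L refl = <⇒≱ (+-monoʳ-< 1 (∈⇒multiplicity>0 y∈L))
                         (subst (λ t → t + multiplicity x L ≤ 1) (cong ⟦_⟧ (dec-true (x ≟ x) refl)) (≤1 x))

    enumerates⇒unique : ∀ {L} → Enumerates L → Unique L
    enumerates⇒unique {L} en = multiplicity≤1⇒unique L (λ x → ≤-reflexive (occursOnce en x))

    ∑-δ : ∀ {L} → Enumerates L → ∀ x (f : A → ℕ) → ∑[ y ∈ L ] (⟦ does (y ≟ x) ⟧ * f y) ≡ f x
    ∑-δ {L} en x f = begin
      ∑[ y ∈ L ] (⟦ does (y ≟ x) ⟧ * f y)  ≡⟨ ∑-cong L only-x ⟩
      ∑[ y ∈ L ] (⟦ does (y ≟ x) ⟧ * f x)  ≡⟨ *-distribʳ-∑ L (f x) _ ⟨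
      multiplicity x L * f x              ≡⟨ cong (_* f x) (occursOnce en x) ⟩
      1 * f x                             ≡⟨ *-identityˡ (f x) ⟩
      f x                                 ∎
      where
      open ≡-Reasoning
      only-x : ∀ y → ⟦ does (y ≟ x) ⟧ * f y ≡ ⟦ does (y ≟ x) ⟧ * f x
      only-x y with y ≟ x
      ... | yes refl = refl
      ... | no _ = refl

    ∑-reindex : ∀ {L} → Enumerates L → (σ τ : A → A) → (∀ x → σ (τ x) ≡ x) → (∀ x → τ (σ x) ≡ x) →
                (f : A → ℕ) → ∑ L f ≡ ∑[ x ∈ L ] f (σ x)
    ∑-reindex {L} en σ τ στ τσ f = begin
      ∑ L f
        ≡⟨ ∑-partition L L (λ y x → does (y ≟ σ x)) one-preimage f ⟩
      ∑[ x ∈ L ] ∑[ y ∈ L ] (⟦ does (y ≟ σ x) ⟧ * f y)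
        ≡⟨ ∑-cong L (λ x → ∑-δ en (σ x) f) ⟩
      ∑[ x ∈ L ] f (σ x) ∎
      where
      open ≡-Reasoning
      preimage : ∀ y x → ⟦ does (y ≟ σ x) ⟧ ≡ ⟦ does (x ≟ τ y) ⟧
      preimage y x with y ≟ σ x | x ≟ τ y
      ... | yes _ | yes _ = refl
      ... | no _  | no _  = refl
      ... | yes y≡σx | no x≢τy = contradiction (trans (sym (τσ x)) (cong τ (sym y≡σx))) x≢τy
      ... | no y≢σx  | yes x≡τy = contradiction (trans (sym (στ y)) (cong σ (sym x≡τy))) y≢σx
      one-preimage : ∀ y → ∑[ x ∈ L ] ⟦ does (y ≟ σ x) ⟧ ≡ 1
      one-preimage y = trans (∑-cong L (preimage y)) (occursOnce en (τ y))

  open Enumeration public using (Enumerates; occursOnce; multiplicity)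

  module _ {_≟ᴬ_ : DecidableEquality A} {_≟ᴮ_ : DecidableEquality B} {L : List A} {M : List B}
           (enL : Enumerates _≟ᴬ_ L) (enM : Enumerates _≟ᴮ_ M) where

    ∑∑-δ : ∀ x y → ∑[ a ∈ L ] ∑[ b ∈ M ] (⟦ does (a ≟ᴬ x) ⟧ * ⟦ does (b ≟ᴮ y) ⟧) ≡ 1
    ∑∑-δ x y = begin
      ∑[ a ∈ L ] ∑[ b ∈ M ] (⟦ does (a ≟ᴬ x) ⟧ * ⟦ does (b ≟ᴮ y) ⟧)
        ≡⟨ ∑-cong L (λ a → *-distribˡ-∑ M ⟦ does (a ≟ᴬ x) ⟧ (λ b → ⟦ does (b ≟ᴮ y) ⟧)) ⟨
      ∑[ a ∈ L ] (⟦ does (a ≟ᴬ x) ⟧ * multiplicity _≟ᴮ_ y M)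
        ≡⟨ ∑-cong L (λ a → cong (⟦ does (a ≟ᴬ x) ⟧ *_) (occursOnce enM y)) ⟩
      ∑[ a ∈ L ] (⟦ does (a ≟ᴬ x) ⟧ * 1)
        ≡⟨ ∑-cong L (λ a → *-identityʳ _) ⟩
      multiplicity _≟ᴬ_ x L
        ≡⟨ occursOnce enL x ⟩
      1 ∎
      where open ≡-Reasoning

    ⟦≟×≟⟧ : ∀ a b x y →
            ⟦ does (×-≡-dec _≟ᴬ_ _≟ᴮ_ (a , b) (x , y)) ⟧ ≡ ⟦ does (a ≟ᴬ x) ⟧ * ⟦ does (b ≟ᴮ y) ⟧
    ⟦≟×≟⟧ a b x y with a ≟ᴬ x | b ≟ᴮ y | ×-≡-dec _≟ᴬ_ _≟ᴮ_ (a , b) (x , y)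
    ... | yes _    | yes _    | yes _   = refl
    ... | yes refl | yes refl | no ab≢xy = contradiction refl ab≢xy
    ... | no _     | _        | no _    = refl
    ... | yes _    | no _     | no _    = refl
    ... | no a≢x   | _        | yes ab≡xy = contradiction (cong proj₁ ab≡xy) a≢x
    ... | yes _    | no b≢y   | yes ab≡xy = contradiction (cong proj₂ ab≡xy) b≢y

    enumerates-cartesianProduct : Enumerates (×-≡-dec _≟ᴬ_ _≟ᴮ_) (cartesianProduct L M)
    occursOnce enumerates-cartesianProduct (x , y) = begin
      multiplicity (×-≡-dec _≟ᴬ_ _≟ᴮ_) (x , y) (cartesianProduct L M)
        ≡⟨ ∑-cartesianProduct L M _ ⟩
      ∑[ a ∈ L ] ∑[ b ∈ M ] ⟦ does (×-≡-dec _≟ᴬ_ _≟ᴮ_ (a , b) (x , y)) ⟧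
        ≡⟨ ∑-cong L (λ a → ∑-cong M (λ b → ⟦≟×≟⟧ a b x y)) ⟩
      ∑[ a ∈ L ] ∑[ b ∈ M ] (⟦ does (a ≟ᴬ x) ⟧ * ⟦ does (b ≟ᴮ y) ⟧)
        ≡⟨ ∑∑-δ x y ⟩
      1 ∎
      where open ≡-Reasoning

  module _ {_≟_ : DecidableEquality A} {L : List A} (enL : Enumerates _≟_ L) where

    enumerates-∷ : ∀ {n} {M : List (Vec A n)} → Enumerates (Vecₚ.≡-dec _≟_) M →
                   Enumerates (Vecₚ.≡-dec _≟_) (concatMap (λ a → map (a ∷_) M) L)
    occursOnce (enumerates-∷ {M = M} enM) (x ∷ xs) = begin
      multiplicity (Vecₚ.≡-dec _≟_) (x ∷ xs) (concatMap (λ a → map (a ∷_) M) L)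
        ≡⟨ ∑-concatMap L _ _ ⟩
      ∑[ a ∈ L ] ∑ (map (a ∷_) M) (λ v → ⟦ does (Vecₚ.≡-dec _≟_ v (x ∷ xs)) ⟧)
        ≡⟨ ∑-cong L (λ a → ∑-map M (a ∷_) _) ⟩
      ∑[ a ∈ L ] ∑[ v ∈ M ] ⟦ does (a ≟ x) ∧ does (Vecₚ.≡-dec _≟_ v xs) ⟧
        ≡⟨ ∑-cong L (λ a → ∑-cong M (λ v → ⟦∧⟧ (does (a ≟ x)) _)) ⟩
      ∑[ a ∈ L ] ∑[ v ∈ M ] (⟦ does (a ≟ x) ⟧ * ⟦ does (Vecₚ.≡-dec _≟_ v xs) ⟧)
        ≡⟨ ∑∑-δ enL enM x xs ⟩
      1 ∎
      where open ≡-Reasoning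

  enumerates-allFin : ∀ n → Enumerates _≟ᶠ_ (allFin n)
  occursOnce (enumerates-allFin (suc n)) x =
    trans (cong (λ L → ⟦ does (zero ≟ᶠ x) ⟧ + ∑[ y ∈ L ] ⟦ does (y ≟ᶠ x) ⟧) (sym (Listₚ.map-tabulate id suc)))
          (trans (cong (⟦ does (zero ≟ᶠ x) ⟧ +_) (∑-map (allFin n) suc _)) (split x))
    where
    split : ∀ x → ⟦ does (zero ≟ᶠ x) ⟧ + ∑[ y ∈ allFin n ] ⟦ does (suc y ≟ᶠ x) ⟧ ≡ 1
    split zero = cong suc (∑-zero (allFin n) (λ _ → refl))
    split (suc x) = occursOnce (enumerates-allFin n) x

  module _ {P : A → Bool} where

    any⁺ : ∀ {x L} → x ∈ L → P x ≡ true → any P L ≡ true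
    any⁺ (here refl) px rewrite px = refl
    any⁺ (there {x = y} x∈L) px with P y
    ... | true = refl
    ... | false = any⁺ x∈L px

    any⁻ : ∀ L → any P L ≡ true → ∃[ x ] P x ≡ true
    any⁻ (x ∷ L) h with P x in px
    ... | true = x , px
    ... | false = any⁻ L h

    all⁺ : ∀ L → (∀ x → P x ≡ true) → all P L ≡ true
    all⁺ [] h = refl
    all⁺ (x ∷ L) h rewrite h x = all⁺ L h

    all⁻ : ∀ {x L} → all P L ≡ true → x ∈ L → P x ≡ true
    all⁻ {L = y ∷ L} h x∈L with P y in py
    all⁻ h (here refl) | true = py
    all⁻ h (there x∈L) | true = all⁻ h x∈L

module ℤMod (n : ℕ) .{{_ : NonZero n}} where

  open import Algebra.Structures using (IsCommutativeRing)
  open import Algebra.Consequences.Propositional using (comm∧idˡ⇒id; comm∧invˡ⇒inv; comm∧distrˡ⇒distr)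
  open import Data.Fin using (Fin; toℕ)
  open import Data.Fin.Properties using (toℕ-injective; toℕ-fromℕ<; fromℕ<-cong; toℕ<n)
  open import Data.Nat as ℕ using (_%_; _∸_)
  import Data.Nat.Properties as ℕ
  open import Data.Nat.DivMod using (_mod_; %-distribˡ-+; %-distribˡ-*; m<n⇒m%n≡m; [m+n]%n≡m%n)
  open import Data.Product using (_,_)
  open import Relation.Binary.PropositionalEquality

  infixl 6 _+_
  infixl 7 _*_

  ι : ℕ → Fin n
  ι m = m mod n

  _+_ _*_ : Fin n → Fin n → Fin n
  a + b = ι (toℕ a ℕ.+ toℕ b)
  a * b = ι (toℕ a ℕ.* toℕ b)

  0# 1# : Fin n
  0# = ι 0
  1# = ι 1

  -_ : Fin n → Fin n
  - a = ι (n ∸ toℕ a)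

  toℕ-ι : ∀ m → toℕ (ι m) ≡ m % n
  toℕ-ι m = toℕ-fromℕ< _

  ι-toℕ : ∀ a → ι (toℕ a) ≡ a
  ι-toℕ a = toℕ-injective (trans (toℕ-ι (toℕ a)) (m<n⇒m%n≡m (toℕ<n a)))

  -- ι is onto and (by ι-+ and ι-*) a semiring homomorphism, so each ring law below is
  -- obtained by writing the arguments as ι m and using the law in ℕ.
  ι-elim : {P : Fin n → Set} → (∀ m → P (ι m)) → ∀ a → P a
  ι-elim {P} h a = subst P (ι-toℕ a) (h (toℕ a))

  ι-cong% : ∀ {m m′} → m % n ≡ m′ % n → ι m ≡ ι m′
  ι-cong% {m} {m′} eq = fromℕ<-cong (m % n) (m′ % n) eq _ _

  ι-+ : ∀ m m′ → ι m + ι m′ ≡ ι (m ℕ.+ m′)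
  ι-+ m m′ = ι-cong% (begin
    (toℕ (ι m) ℕ.+ toℕ (ι m′)) % n  ≡⟨ cong₂ (λ x y → (x ℕ.+ y) % n) (toℕ-ι m) (toℕ-ι m′) ⟩
    (m % n ℕ.+ m′ % n) % n          ≡⟨ %-distribˡ-+ m m′ n ⟨
    (m ℕ.+ m′) % n                  ∎)
    where open ≡-Reasoning

  ι-* : ∀ m m′ → ι m * ι m′ ≡ ι (m ℕ.* m′)
  ι-* m m′ = ι-cong% (begin
    (toℕ (ι m) ℕ.* toℕ (ι m′)) % n  ≡⟨ cong₂ (λ x y → (x ℕ.* y) % n) (toℕ-ι m) (toℕ-ι m′) ⟩
    (m % n ℕ.* (m′ % n)) % n        ≡⟨ %-distribˡ-* m m′ n ⟨
    (m ℕ.* m′) % n                  ∎)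
    where open ≡-Reasoning

  +-assoc : ∀ a b c → (a + b) + c ≡ a + (b + c)
  +-assoc = ι-elim λ m → ι-elim λ m′ → ι-elim λ m″ → begin
    (ι m + ι m′) + ι m″      ≡⟨ cong (_+ ι m″) (ι-+ m m′) ⟩
    ι (m ℕ.+ m′) + ι m″      ≡⟨ ι-+ (m ℕ.+ m′) m″ ⟩
    ι (m ℕ.+ m′ ℕ.+ m″)      ≡⟨ cong ι (ℕ.+-assoc m m′ m″) ⟩
    ι (m ℕ.+ (m′ ℕ.+ m″))    ≡⟨ ι-+ m (m′ ℕ.+ m″) ⟨
    ι m + ι (m′ ℕ.+ m″)      ≡⟨ cong (ι m +_) (ι-+ m′ m″) ⟨
    ι m + (ι m′ + ι m″)      ∎
    where open ≡-Reasoning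

  *-assoc : ∀ a b c → (a * b) * c ≡ a * (b * c)
  *-assoc = ι-elim λ m → ι-elim λ m′ → ι-elim λ m″ → begin
    (ι m * ι m′) * ι m″      ≡⟨ cong (_* ι m″) (ι-* m m′) ⟩
    ι (m ℕ.* m′) * ι m″      ≡⟨ ι-* (m ℕ.* m′) m″ ⟩
    ι (m ℕ.* m′ ℕ.* m″)      ≡⟨ cong ι (ℕ.*-assoc m m′ m″) ⟩
    ι (m ℕ.* (m′ ℕ.* m″))    ≡⟨ ι-* m (m′ ℕ.* m″) ⟨
    ι m * ι (m′ ℕ.* m″)      ≡⟨ cong (ι m *_) (ι-* m′ m″) ⟨
    ι m * (ι m′ * ι m″)      ∎
    where open ≡-Reasoning

  *-distribˡ-+ : ∀ a b c → a * (b + c) ≡ a * b + a * c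
  *-distribˡ-+ = ι-elim λ m → ι-elim λ m′ → ι-elim λ m″ → begin
    ι m * (ι m′ + ι m″)             ≡⟨ cong (ι m *_) (ι-+ m′ m″) ⟩
    ι m * ι (m′ ℕ.+ m″)             ≡⟨ ι-* m (m′ ℕ.+ m″) ⟩
    ι (m ℕ.* (m′ ℕ.+ m″))           ≡⟨ cong ι (ℕ.*-distribˡ-+ m m′ m″) ⟩
    ι (m ℕ.* m′ ℕ.+ m ℕ.* m″)       ≡⟨ ι-+ (m ℕ.* m′) (m ℕ.* m″) ⟨
    ι (m ℕ.* m′) + ι (m ℕ.* m″)     ≡⟨ cong₂ _+_ (ι-* m m′) (ι-* m m″) ⟨
    ι m * ι m′ + ι m * ι m″         ∎
    where open ≡-Reasoning

  +-comm : ∀ a b → a + b ≡ b + a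
  +-comm a b = cong ι (ℕ.+-comm (toℕ a) (toℕ b))

  *-comm : ∀ a b → a * b ≡ b * a
  *-comm a b = cong ι (ℕ.*-comm (toℕ a) (toℕ b))

  +-identityˡ : ∀ a → 0# + a ≡ a
  +-identityˡ = ι-elim λ m → ι-+ 0 m

  *-identityˡ : ∀ a → 1# * a ≡ a
  *-identityˡ = ι-elim λ m → trans (ι-* 1 m) (cong ι (ℕ.*-identityˡ m))

  -‿inverseˡ : ∀ a → - a + a ≡ 0#
  -‿inverseˡ a = begin
    ι (n ∸ toℕ a) + a              ≡⟨ cong (ι (n ∸ toℕ a) +_) (ι-toℕ a) ⟨
    ι (n ∸ toℕ a) + ι (toℕ a)      ≡⟨ ι-+ (n ∸ toℕ a) (toℕ a) ⟩
    ι (n ∸ toℕ a ℕ.+ toℕ a)        ≡⟨ cong ι (ℕ.m∸n+n≡m (ℕ.<⇒≤ (toℕ<n a))) ⟩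
    ι n                            ≡⟨ ι-cong% ([m+n]%n≡m%n 0 n) ⟩
    0#                             ∎
    where open ≡-Reasoning

  isCommutativeRing : IsCommutativeRing _≡_ _+_ _*_ -_ 0# 1#
  isCommutativeRing = record
    { isRing = record
      { +-isAbelianGroup = record
        { isGroup = record
          { isMonoid = record
            { isSemigroup = record
              { isMagma = record { isEquivalence = isEquivalence ; ∙-cong = cong₂ _+_ }
              ; assoc = +-assoc
              }
            ; identity = comm∧idˡ⇒id +-comm +-identityˡ
            }
          ; inverse = comm∧invˡ⇒inv +-comm -‿inverseˡ
          ; ⁻¹-cong = cong -_
          }
        ; comm = +-comm
        }
      ; *-cong = cong₂ _*_
      ; *-assoc = *-assoc
      ; *-identity = comm∧idˡ⇒id *-comm *-identityˡ
      ; distrib = comm∧distrˡ⇒distr (cong₂ _+_) *-comm *-distribˡ-+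
      }
    ; *-comm = *-comm
    }

module Matrix where

  open import Algebra.Bundles using (Semiring)
  open import Algebra.Core using (Op₂)
  open import Algebra.Structures using (IsSemiring)
  open import Data.Bool using (if_then_else_)
  open import Data.Fin using (Fin; zero; suc; _≟_)
  open import Data.Nat using () renaming (suc to 1+)
  open import Data.Vec using (Vec; []; _∷_; lookup; map; zipWith; foldr′; replicate; tabulate; transpose; _⊛_)
  open import Data.Vec.Properties using (lookup-map; lookup-zipWith; lookup-replicate; lookup∘tabulate; lookup-⊛)
  open import Data.Vec.Relation.Binary.Pointwise.Extensional using (ext; Pointwise-≡⇒≡)
  open import Relation.Nullary using (does)
  open import Relation.Binary.PropositionalEquality

  private
    variable
      l m n : ℕ

  lookup-transpose : ∀ {A : Set} (M : Vec (Vec A n) m) i j → lookup (lookup (transpose M) j) i ≡ lookup (lookup M i) j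
  lookup-transpose {n = n} (row ∷ M) i j = trans (cong (λ f → lookup f i) column-∷) (lookup-∷ i)
    where
    column-∷ : lookup (transpose (row ∷ M)) j ≡ lookup row j ∷ lookup (transpose M) j
    column-∷ = trans (lookup-⊛ j (replicate n _∷_ ⊛ row) (transpose M))
                     (cong (λ f → f (lookup (transpose M) j))
                           (trans (lookup-⊛ j (replicate n _∷_) row)
                                  (cong (λ f → f (lookup row j)) (lookup-replicate j _∷_))))
    lookup-∷ : ∀ i → lookup (lookup row j ∷ lookup (transpose M) j) i ≡ lookup (lookup (row ∷ M) i) j
    lookup-∷ zero = refl
    lookup-∷ (suc i) = lookup-transpose M i j

  module Matrices {A : Set} {_⊕_ _⊗_ : Op₂ A} {𝟘 𝟙 : A}
                  (isSemiring : IsSemiring _≡_ _⊕_ _⊗_ 𝟘 𝟙) where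

    private
      semiring : Semiring _ _
      semiring = record { isSemiring = isSemiring }

    open Semiring semiring using (_+_; _*_; 0#; 1#; +-identityˡ; +-identityʳ; *-identityˡ; zeroˡ; zeroʳ; *-assoc; distribˡ)
    open import Algebra.Properties.Semiring.Sum semiring
      using (sum-syntax; sum-cong-≗; sum-replicate-zero; ∑-distrib-+; ∑-comm; *-distribˡ-sum; *-distribʳ-sum)

    infixl 6 _+ᵛ_
    infixr 7 _·ᵛ_ _·ᴹ_

    _+ᵛ_ : Vec A n → Vec A n → Vec A n
    _+ᵛ_ = zipWith _+_

    0ᵛ : Vec A n
    0ᵛ = replicate _ 0#

    dot : Vec A n → Vec A n → A
    dot u w = foldr′ _+_ 0# (zipWith _*_ u w)

    _·ᵛ_ : Vec (Vec A n) m → Vec A n → Vec A m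
    M ·ᵛ x = map (λ row → dot row x) M

    _·ᴹ_ : Vec (Vec A n) m → Vec (Vec A l) n → Vec (Vec A l) m
    M ·ᴹ N = map (λ row → map (dot row) (transpose N)) M

    δ : Fin n → Fin n → A
    δ i j = if does (i ≟ j) then 1# else 0#

    I : Vec (Vec A n) n
    I = tabulate (λ i → tabulate (δ i))

    private
      infix 30 _[_,_]
      _[_,_] : Vec (Vec A n) m → Fin m → Fin n → A
      M [ i , j ] = lookup (lookup M i) j

      matrix-ext : {M N : Vec (Vec A n) m} → (∀ i j → M [ i , j ] ≡ N [ i , j ]) → M ≡ N
      matrix-ext e = Pointwise-≡⇒≡ (ext (λ i → Pointwise-≡⇒≡ (ext (e i))))

      vector-ext : {u w : Vec A n} → (∀ i → lookup u i ≡ lookup w i) → u ≡ w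
      vector-ext e = Pointwise-≡⇒≡ (ext e)

    dot≡∑ : (u w : Vec A n) → dot u w ≡ ∑[ i < n ] (lookup u i * lookup w i)
    dot≡∑ [] [] = refl
    dot≡∑ (x ∷ u) (y ∷ w) = cong ((x * y) +_) (dot≡∑ u w)

    lookup-·ᵛ : ∀ (M : Vec (Vec A n) m) x i → lookup (M ·ᵛ x) i ≡ ∑[ k < n ] (M [ i , k ] * lookup x k)
    lookup-·ᵛ M x i = trans (lookup-map i _ M) (dot≡∑ (lookup M i) x)

    lookup-·ᴹ : ∀ (M : Vec (Vec A n) m) (N : Vec (Vec A l) n) i j →
                (M ·ᴹ N) [ i , j ] ≡ ∑[ k < n ] (M [ i , k ] * N [ k , j ])
    lookup-·ᴹ M N i j = begin
      (M ·ᴹ N) [ i , j ]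
        ≡⟨ cong (λ r → lookup r j) (lookup-map i _ M) ⟩
      lookup (map (dot (lookup M i)) (transpose N)) j
        ≡⟨ lookup-map j _ (transpose N) ⟩
      dot (lookup M i) (lookup (transpose N) j)
        ≡⟨ dot≡∑ (lookup M i) _ ⟩
      ∑[ k < _ ] (M [ i , k ] * lookup (lookup (transpose N) j) k)
        ≡⟨ sum-cong-≗ (λ k → cong (M [ i , k ] *_) (lookup-transpose N k j)) ⟩
      ∑[ k < _ ] (M [ i , k ] * N [ k , j ]) ∎
      where open ≡-Reasoning

    ∑-assoc : (a : Fin n → A) (b : Fin n → Fin l → A) (c : Fin l → A) →
              ∑[ k < l ] ((∑[ j < n ] (a j * b j k)) * c k) ≡ ∑[ j < n ] (a j * (∑[ k < l ] (b j k * c k)))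
    ∑-assoc {n} {l} a b c = begin
      ∑[ k < l ] ((∑[ j < n ] (a j * b j k)) * c k)
        ≡⟨ sum-cong-≗ (λ k → *-distribʳ-sum (c k) (λ j → a j * b j k)) ⟩
      ∑[ k < l ] ∑[ j < n ] ((a j * b j k) * c k)
        ≡⟨ ∑-comm (λ k j → (a j * b j k) * c k) ⟩
      ∑[ j < n ] ∑[ k < l ] ((a j * b j k) * c k)
        ≡⟨ sum-cong-≗ (λ j → sum-cong-≗ (λ k → *-assoc (a j) (b j k) (c k))) ⟩
      ∑[ j < n ] ∑[ k < l ] (a j * (b j k * c k))
        ≡⟨ sum-cong-≗ (λ j → *-distribˡ-sum (a j) (λ k → b j k * c k)) ⟨
      ∑[ j < n ] (a j * (∑[ k < l ] (b j k * c k))) ∎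
      where open ≡-Reasoning

    ∑-δ : ∀ (i : Fin n) f → ∑[ k < n ] (δ i k * f k) ≡ f i
    ∑-δ {1+ n} zero f = begin
      1# * f zero + (∑[ k < n ] (0# * f (suc k)))
        ≡⟨ cong₂ _+_ (*-identityˡ (f zero)) (sum-cong-≗ (λ k → zeroˡ (f (suc k)))) ⟩
      f zero + (∑[ k < n ] 0#)
        ≡⟨ cong (f zero +_) (sum-replicate-zero n) ⟩
      f zero + 0#
        ≡⟨ +-identityʳ (f zero) ⟩
      f zero ∎
      where open ≡-Reasoning
    ∑-δ {1+ n} (suc i) f = begin
      0# * f zero + (∑[ k < n ] (δ i k * f (suc k)))
        ≡⟨ cong (_+ (∑[ k < n ] (δ i k * f (suc k)))) (zeroˡ (f zero)) ⟩
      0# + (∑[ k < n ] (δ i k * f (suc k)))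
        ≡⟨ +-identityˡ _ ⟩
      ∑[ k < n ] (δ i k * f (suc k))
        ≡⟨ ∑-δ i (λ k → f (suc k)) ⟩
      f (suc i) ∎
      where open ≡-Reasoning

    lookup-I : ∀ (i j : Fin n) → I [ i , j ] ≡ δ i j
    lookup-I i j = trans (cong (λ r → lookup r j) (lookup∘tabulate _ i)) (lookup∘tabulate _ j)

    I-·ᵛ : (x : Vec A n) → I ·ᵛ x ≡ x
    I-·ᵛ {n} x = vector-ext λ i → begin
      lookup (I ·ᵛ x) i                  ≡⟨ lookup-·ᵛ I x i ⟩
      ∑[ k < n ] (I [ i , k ] * lookup x k) ≡⟨ sum-cong-≗ (λ k → cong (_* lookup x k) (lookup-I i k)) ⟩
      ∑[ k < n ] (δ i k * lookup x k) ≡⟨ ∑-δ i (lookup x) ⟩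
      lookup x i                         ∎
      where open ≡-Reasoning

    I-·ᴹ : (M : Vec (Vec A l) n) → I ·ᴹ M ≡ M
    I-·ᴹ {n = n} M = matrix-ext λ i j → begin
      (I ·ᴹ M) [ i , j ]                     ≡⟨ lookup-·ᴹ I M i j ⟩
      ∑[ k < n ] (I [ i , k ] * M [ k , j ]) ≡⟨ sum-cong-≗ (λ k → cong (_* M [ k , j ]) (lookup-I i k)) ⟩
      ∑[ k < n ] (δ i k * M [ k , j ]) ≡⟨ ∑-δ i (λ k → M [ k , j ]) ⟩
      M [ i , j ]                            ∎
      where open ≡-Reasoning

    ·ᵛ-assoc : ∀ (M : Vec (Vec A n) m) (N : Vec (Vec A l) n) x → (M ·ᴹ N) ·ᵛ x ≡ M ·ᵛ N ·ᵛ x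
    ·ᵛ-assoc {n} {l = l} M N x = vector-ext λ i → begin
      lookup ((M ·ᴹ N) ·ᵛ x) i
        ≡⟨ lookup-·ᵛ (M ·ᴹ N) x i ⟩
      ∑[ k < l ] ((M ·ᴹ N) [ i , k ] * lookup x k)
        ≡⟨ sum-cong-≗ (λ k → cong (_* lookup x k) (lookup-·ᴹ M N i k)) ⟩
      ∑[ k < l ] ((∑[ j < n ] (M [ i , j ] * N [ j , k ])) * lookup x k)
        ≡⟨ ∑-assoc (λ j → M [ i , j ]) (λ j k → N [ j , k ]) (lookup x) ⟩
      ∑[ j < n ] (M [ i , j ] * (∑[ k < l ] (N [ j , k ] * lookup x k)))
        ≡⟨ sum-cong-≗ (λ j → cong (M [ i , j ] *_) (lookup-·ᵛ N x j)) ⟨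
      ∑[ j < n ] (M [ i , j ] * lookup (N ·ᵛ x) j)
        ≡⟨ lookup-·ᵛ M (N ·ᵛ x) i ⟨
      lookup (M ·ᵛ N ·ᵛ x) i ∎
      where open ≡-Reasoning

    ·ᴹ-assoc : ∀ {k} (M : Vec (Vec A n) m) (N : Vec (Vec A l) n) (P : Vec (Vec A k) l) →
               (M ·ᴹ N) ·ᴹ P ≡ M ·ᴹ N ·ᴹ P
    ·ᴹ-assoc {n} {l = l} M N P = matrix-ext λ i j → begin
      ((M ·ᴹ N) ·ᴹ P) [ i , j ]
        ≡⟨ lookup-·ᴹ (M ·ᴹ N) P i j ⟩
      ∑[ k < l ] ((M ·ᴹ N) [ i , k ] * P [ k , j ])
        ≡⟨ sum-cong-≗ (λ k → cong (_* P [ k , j ]) (lookup-·ᴹ M N i k)) ⟩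
      ∑[ k < l ] ((∑[ h < n ] (M [ i , h ] * N [ h , k ])) * P [ k , j ])
        ≡⟨ ∑-assoc (λ h → M [ i , h ]) (λ h k → N [ h , k ]) (λ k → P [ k , j ]) ⟩
      ∑[ h < n ] (M [ i , h ] * (∑[ k < l ] (N [ h , k ] * P [ k , j ])))
        ≡⟨ sum-cong-≗ (λ h → cong (M [ i , h ] *_) (lookup-·ᴹ N P h j)) ⟨
      ∑[ h < n ] (M [ i , h ] * (N ·ᴹ P) [ h , j ])
        ≡⟨ lookup-·ᴹ M (N ·ᴹ P) i j ⟨
      (M ·ᴹ N ·ᴹ P) [ i , j ] ∎
      where open ≡-Reasoning

    ·ᵛ-distrib-+ᵛ : ∀ (M : Vec (Vec A n) m) x y → M ·ᵛ (x +ᵛ y) ≡ M ·ᵛ x +ᵛ M ·ᵛ y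
    ·ᵛ-distrib-+ᵛ {n} M x y = vector-ext λ i → begin
      lookup (M ·ᵛ (x +ᵛ y)) i
        ≡⟨ lookup-·ᵛ M (x +ᵛ y) i ⟩
      ∑[ k < n ] (M [ i , k ] * lookup (x +ᵛ y) k)
        ≡⟨ sum-cong-≗ (λ k → trans (cong (M [ i , k ] *_) (lookup-zipWith _+_ k x y)) (distribˡ _ _ _)) ⟩
      ∑[ k < n ] ((M [ i , k ] * lookup x k) + (M [ i , k ] * lookup y k))
        ≡⟨ ∑-distrib-+ (λ k → M [ i , k ] * lookup x k) (λ k → M [ i , k ] * lookup y k) ⟩
      (∑[ k < n ] (M [ i , k ] * lookup x k)) + (∑[ k < n ] (M [ i , k ] * lookup y k))
        ≡⟨ cong₂ _+_ (lookup-·ᵛ M x i) (lookup-·ᵛ M y i) ⟨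
      lookup (M ·ᵛ x) i + lookup (M ·ᵛ y) i
        ≡⟨ lookup-zipWith _+_ i (M ·ᵛ x) (M ·ᵛ y) ⟨
      lookup (M ·ᵛ x +ᵛ M ·ᵛ y) i ∎
      where open ≡-Reasoning

    ·ᵛ-0ᵛ : ∀ (M : Vec (Vec A n) m) → M ·ᵛ 0ᵛ ≡ 0ᵛ
    ·ᵛ-0ᵛ {n} M = vector-ext λ i → begin
      lookup (M ·ᵛ 0ᵛ) i
        ≡⟨ lookup-·ᵛ M 0ᵛ i ⟩
      ∑[ k < n ] (M [ i , k ] * lookup 0ᵛ k)
        ≡⟨ sum-cong-≗ (λ k → trans (cong (M [ i , k ] *_) (lookup-replicate k 0#)) (zeroʳ _)) ⟩
      ∑[ k < n ] 0#
        ≡⟨ sum-replicate-zero n ⟩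
      0#
        ≡⟨ lookup-replicate i 0# ⟨
      lookup 0ᵛ i ∎
      where open ≡-Reasoning

module AffineGroup (p : ℕ) .{{_ : NonZero p}} (d : ℕ) where

  open import Defs
  open Counting
  open Matrix
  open import Algebra.Bundles using (AbelianGroup)
  open import Algebra.Structures using (IsAbelianGroup; IsCommutativeRing)
  open import Data.Bool using (Bool; true; false; _∧_) renaming (_≟_ to _≟ᴮ_)
  open import Data.Bool.ListAction using (all)
  open import Data.List using (List; []; _∷_; length; allFin; concatMap; map)
  import Data.List.Properties as Listₚ
  open import Data.List.Membership.Propositional using (_∈_)
  open import Data.List.Relation.Unary.All using (All; []; _∷_)
  open import Data.List.Relation.Unary.AllPairs using ([]; _∷_)
  open import Data.List.Relation.Unary.Unique.Propositional using (Unique)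
  open import Data.Nat using (zero; suc; _*_; _^_; _+_)
  import Data.Nat.Properties as ℕ
  open import Data.Product using (_,_; proj₁; _×_; ∃-syntax)
  open import Data.Vec using ([]; _∷_) renaming (map to mapᵛ)
  import Data.Vec.Properties as Vecₚ
  open import Data.Vec.Properties
    using (zipWith-assoc; zipWith-identityˡ; zipWith-identityʳ; zipWith-inverseˡ; zipWith-inverseʳ; zipWith-comm)
  open import Relation.Binary using (DecidableEquality)
  open import Relation.Binary.PropositionalEquality
  open import Relation.Nullary using (does)
  open import Relation.Nullary.Decidable using (dec-true; dec-false)

  private
    module F = ℤMod p
    module 𝔽 = IsCommutativeRing F.isCommutativeRing

  -- Over ℤMod p these unfold definitionally to Defs' _+V_, zeroV, _·V_, _·M_ and idM.
  open Matrices 𝔽.isSemiring public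
    using (_+ᵛ_; 0ᵛ; _·ᵛ_; _·ᴹ_; I; I-·ᵛ; I-·ᴹ; ·ᵛ-assoc; ·ᴹ-assoc; ·ᵛ-distrib-+ᵛ; ·ᵛ-0ᵛ)

  infixr 9 _∘ᴬ_
  infixr 5 _⟨$⟩_

  -ᵛ_ : V p d → V p d
  -ᵛ_ = mapᵛ F.-_

  +ᵛ-isAbelianGroup : IsAbelianGroup _≡_ _+ᵛ_ 0ᵛ -ᵛ_
  +ᵛ-isAbelianGroup = record
    { isGroup = record
      { isMonoid = record
        { isSemigroup = record
          { isMagma = record { isEquivalence = isEquivalence ; ∙-cong = cong₂ _+ᵛ_ }
          ; assoc = zipWith-assoc 𝔽.+-assoc
          }
        ; identity = zipWith-identityˡ 𝔽.+-identityˡ , zipWith-identityʳ 𝔽.+-identityʳ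
        }
      ; inverse = zipWith-inverseˡ 𝔽.-‿inverseˡ , zipWith-inverseʳ 𝔽.-‿inverseʳ
      ; ⁻¹-cong = cong -ᵛ_
      }
    ; comm = zipWith-comm 𝔽.+-comm
    }

  +ᵛ-abelianGroup : AbelianGroup _ _
  +ᵛ-abelianGroup = record { isAbelianGroup = +ᵛ-isAbelianGroup }

  open IsAbelianGroup +ᵛ-isAbelianGroup public
    using ()
    renaming (assoc to +ᵛ-assoc; identityʳ to +ᵛ-identityʳ; inverseˡ to +ᵛ-inverseˡ; inverseʳ to +ᵛ-inverseʳ)
  open import Algebra.Properties.AbelianGroup +ᵛ-abelianGroup public
    using (inverseˡ-unique; \\-leftDividesˡ; \\-leftDividesʳ)

  ·ᵛ-neg : ∀ (A : Mat p d) x → A ·ᵛ (-ᵛ x) ≡ -ᵛ (A ·ᵛ x)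
  ·ᵛ-neg A x = inverseˡ-unique (A ·ᵛ (-ᵛ x)) (A ·ᵛ x) (begin
    A ·ᵛ (-ᵛ x) +ᵛ A ·ᵛ x  ≡⟨ ·ᵛ-distrib-+ᵛ A (-ᵛ x) x ⟨
    A ·ᵛ (-ᵛ x +ᵛ x)      ≡⟨ cong (A ·ᵛ_) (+ᵛ-inverseˡ x) ⟩
    A ·ᵛ 0ᵛ               ≡⟨ ·ᵛ-0ᵛ A ⟩
    0ᵛ                    ∎)
    where open ≡-Reasoning

  _∘ᴬ_ : Aff p d → Aff p d → Aff p d
  _∘ᴬ_ = compose p d

  _⟨$⟩_ : Aff p d → V p d → V p d
  _⟨$⟩_ = apply p d

  idᴬ : Aff p d
  idᴬ = idAff p d

  translation : V p d → Aff p d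
  translation c = (I , c)

  ⟨$⟩-∘ᴬ : ∀ g h x → (g ∘ᴬ h) ⟨$⟩ x ≡ g ⟨$⟩ h ⟨$⟩ x
  ⟨$⟩-∘ᴬ (A , b) (A′ , b′) x = begin
    (A ·ᴹ A′) ·ᵛ x +ᵛ (A ·ᵛ b′ +ᵛ b)   ≡⟨ cong (_+ᵛ (A ·ᵛ b′ +ᵛ b)) (·ᵛ-assoc A A′ x) ⟩
    A ·ᵛ A′ ·ᵛ x +ᵛ (A ·ᵛ b′ +ᵛ b)     ≡⟨ +ᵛ-assoc _ _ _ ⟨
    (A ·ᵛ A′ ·ᵛ x +ᵛ A ·ᵛ b′) +ᵛ b     ≡⟨ cong (_+ᵛ b) (·ᵛ-distrib-+ᵛ A _ _) ⟨
    A ·ᵛ (A′ ·ᵛ x +ᵛ b′) +ᵛ b          ∎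
    where open ≡-Reasoning

  ∘ᴬ-assoc : ∀ g h k → (g ∘ᴬ h) ∘ᴬ k ≡ g ∘ᴬ (h ∘ᴬ k)
  ∘ᴬ-assoc (A , b) (A′ , b′) (A″ , b″) = cong₂ _,_ (·ᴹ-assoc A A′ A″) (⟨$⟩-∘ᴬ (A , b) (A′ , b′) b″)

  translation-∘ᴬ : ∀ c A b → translation c ∘ᴬ (A , b) ≡ (A , b +ᵛ c)
  translation-∘ᴬ c A b = cong₂ _,_ (I-·ᴹ A) (cong (_+ᵛ c) (I-·ᵛ b))

  ∘ᴬ-identityˡ : ∀ g → idᴬ ∘ᴬ g ≡ g
  ∘ᴬ-identityˡ (A , b) = trans (translation-∘ᴬ 0ᵛ A b) (cong (A ,_) (+ᵛ-identityʳ b))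

  translation-⟨$⟩ : ∀ c x → translation c ⟨$⟩ x ≡ x +ᵛ c
  translation-⟨$⟩ c x = cong (_+ᵛ c) (I-·ᵛ x)

  idᴬ-⟨$⟩ : ∀ x → idᴬ ⟨$⟩ x ≡ x
  idᴬ-⟨$⟩ x = trans (translation-⟨$⟩ 0ᵛ x) (+ᵛ-identityʳ x)

  inverse : (g : Aff p d) → Invertible p d (proj₁ g) → Aff p d
  inverse (A , b) (A′ , _) = (A′ , -ᵛ (A′ ·ᵛ b))

  ∘ᴬ-inverseˡ : ∀ g (inv : Invertible p d (proj₁ g)) → inverse g inv ∘ᴬ g ≡ idᴬ
  ∘ᴬ-inverseˡ (A , b) (A′ , _ , A′A≡I) = cong₂ _,_ A′A≡I (+ᵛ-inverseʳ (A′ ·ᵛ b))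

  ∘ᴬ-inverseʳ : ∀ g (inv : Invertible p d (proj₁ g)) → g ∘ᴬ inverse g inv ≡ idᴬ
  ∘ᴬ-inverseʳ (A , b) (A′ , AA′≡I , _) = cong₂ _,_ AA′≡I (begin
    A ·ᵛ (-ᵛ (A′ ·ᵛ b)) +ᵛ b   ≡⟨ cong (_+ᵛ b) (·ᵛ-neg A (A′ ·ᵛ b)) ⟩
    -ᵛ (A ·ᵛ A′ ·ᵛ b) +ᵛ b     ≡⟨ cong (λ y → -ᵛ y +ᵛ b) (·ᵛ-assoc A A′ b) ⟨
    -ᵛ ((A ·ᴹ A′) ·ᵛ b) +ᵛ b   ≡⟨ cong (λ M → -ᵛ (M ·ᵛ b) +ᵛ b) AA′≡I ⟩
    -ᵛ (I ·ᵛ b) +ᵛ b           ≡⟨ cong (λ y → -ᵛ y +ᵛ b) (I-·ᵛ b) ⟩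
    -ᵛ b +ᵛ b                  ≡⟨ +ᵛ-inverseˡ b ⟩
    0ᵛ                         ∎)
    where open ≡-Reasoning

  ⟨$⟩-inverseʳ : ∀ g (inv : Invertible p d (proj₁ g)) y → g ⟨$⟩ inverse g inv ⟨$⟩ y ≡ y
  ⟨$⟩-inverseʳ g inv y =
    trans (sym (⟨$⟩-∘ᴬ g (inverse g inv) y)) (trans (cong (_⟨$⟩ y) (∘ᴬ-inverseʳ g inv)) (idᴬ-⟨$⟩ y))

  ⟨$⟩-inverseˡ : ∀ g (inv : Invertible p d (proj₁ g)) x → inverse g inv ⟨$⟩ g ⟨$⟩ x ≡ x
  ⟨$⟩-inverseˡ g inv x =
    trans (sym (⟨$⟩-∘ᴬ (inverse g inv) g x)) (trans (cong (_⟨$⟩ x) (∘ᴬ-inverseˡ g inv)) (idᴬ-⟨$⟩ x))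

  ∘ᴬ-cancelˡ : ∀ g (inv : Invertible p d (proj₁ g)) h → inverse g inv ∘ᴬ g ∘ᴬ h ≡ h
  ∘ᴬ-cancelˡ g inv h =
    trans (sym (∘ᴬ-assoc (inverse g inv) g h)) (trans (cong (_∘ᴬ h) (∘ᴬ-inverseˡ g inv)) (∘ᴬ-identityˡ h))

  ∘ᴬ-cancelʳ : ∀ g (inv : Invertible p d (proj₁ g)) h → g ∘ᴬ inverse g inv ∘ᴬ h ≡ h
  ∘ᴬ-cancelʳ g inv h =
    trans (sym (∘ᴬ-assoc g (inverse g inv) h)) (trans (cong (_∘ᴬ h) (∘ᴬ-inverseʳ g inv)) (∘ᴬ-identityˡ h))

  allVecs-enumerates : ∀ {A : Set} {_≟_ : DecidableEquality A} {L : List A} → Enumerates _≟_ L →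
                       ∀ n → Enumerates (Vecₚ.≡-dec _≟_) (allVecs p d L n)
  occursOnce (allVecs-enumerates en zero) [] = refl
  allVecs-enumerates en (suc n) = enumerates-∷ en (allVecs-enumerates en n)

  allV-enumerates : Enumerates (_≟V_ p d) (allV p d)
  allV-enumerates = allVecs-enumerates (enumerates-allFin p) d

  allMat : List (Mat p d)
  allMat = allVecs p d (allV p d) d

  allMat-enumerates : Enumerates (_≟M_ p d) allMat
  allMat-enumerates = allVecs-enumerates allV-enumerates d

  allAff-enumerates : Enumerates (_≟A_ p d) (allAff p d)
  allAff-enumerates = enumerates-cartesianProduct allMat-enumerates allV-enumerates

  ∈-allV : ∀ x → x ∈ allV p d
  ∈-allV = Enumeration.enumerates⇒∈ (_≟V_ p d) allV-enumerates

  length-allVecs : ∀ {A : Set} (L : List A) n → length (allVecs p d L n) ≡ length L ^ n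
  length-allVecs L zero = refl
  length-allVecs L (suc n) = begin
    length (concatMap (λ a → map (a ∷_) (allVecs p d L n)) L)
      ≡⟨ length≡∑1 (concatMap (λ a → map (a ∷_) (allVecs p d L n)) L) ⟩
    ∑ (concatMap (λ a → map (a ∷_) (allVecs p d L n)) L) (λ _ → 1)
      ≡⟨ ∑-concatMap L _ _ ⟩
    ∑[ a ∈ L ] ∑ (map (a ∷_) (allVecs p d L n)) (λ _ → 1)
      ≡⟨ ∑-cong L (λ a → sym (length≡∑1 (map (a ∷_) (allVecs p d L n)))) ⟩
    ∑[ a ∈ L ] length (map (a ∷_) (allVecs p d L n))
      ≡⟨ ∑-cong L (λ a → trans (Listₚ.length-map (a ∷_) (allVecs p d L n)) (length-allVecs L n)) ⟩
    ∑[ a ∈ L ] (length L ^ n)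
      ≡⟨ ∑-const L _ ⟩
    length L * length L ^ n ∎
    where open ≡-Reasoning

  length-allV : length (allV p d) ≡ p ^ d
  length-allV = trans (length-allVecs (allFin p) d) (cong (_^ d) (Listₚ.length-tabulate {n = p} (λ i → i)))

  img⁺ : ∀ g (S : Subset p d) {x y} → S x ≡ true → g ⟨$⟩ x ≡ y → img p d g S y ≡ true
  img⁺ g S {x} Sx refl = any⁺ (∈-allV x) (∧-true⁺ Sx (dec-true (_≟V_ p d (g ⟨$⟩ x) (g ⟨$⟩ x)) refl))

  img⁻ : ∀ g (S : Subset p d) y → img p d g S y ≡ true → ∃[ x ] (S x ≡ true × g ⟨$⟩ x ≡ y)
  img⁻ g S y h with any⁻ (allV p d) h
  ... | x , Sx∧gx≡y with ∧-true⁻ Sx∧gx≡y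
  ...   | Sx , gx≡y = x , Sx , does≡true⇒ (_≟V_ p d (g ⟨$⟩ x) y) gx≡y

  img-cong : ∀ g {S S′ : Subset p d} → (∀ z → S z ≡ S′ z) → ∀ y → img p d g S y ≡ img p d g S′ y
  img-cong g {S} {S′} S≗S′ y = true⇔true⇒≡
    (λ h → let (x , Sx , gx≡y) = img⁻ g S y h in img⁺ g S′ (trans (sym (S≗S′ x)) Sx) gx≡y)
    (λ h → let (x , Sx , gx≡y) = img⁻ g S′ y h in img⁺ g S (trans (S≗S′ x) Sx) gx≡y)

  img-∘ᴬ : ∀ g h (S : Subset p d) y → img p d (g ∘ᴬ h) S y ≡ img p d g (img p d h S) y
  img-∘ᴬ g h S y = true⇔true⇒≡
    (λ q → let (x , Sx , ghx≡y) = img⁻ (g ∘ᴬ h) S y q in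
           img⁺ g (img p d h S) (img⁺ h S Sx refl) (trans (sym (⟨$⟩-∘ᴬ g h x)) ghx≡y))
    (λ q → let (z , hSz , gz≡y) = img⁻ g (img p d h S) y q
               (x , Sx , hx≡z) = img⁻ h S z hSz in
           img⁺ (g ∘ᴬ h) S Sx (trans (⟨$⟩-∘ᴬ g h x) (trans (cong (g ⟨$⟩_) hx≡z) gz≡y)))

  stabilises⁺ : ∀ (S : Subset p d) g → (∀ x → S (g ⟨$⟩ x) ≡ S x) → stabilises p d S g ≡ true
  stabilises⁺ S g h =
    all⁺ (allV p d) (λ x → trans (cong (λ b → does (b ≟ᴮ S x)) (h x)) (dec-true (S x ≟ᴮ S x) refl))

  stabilises⁻ : ∀ (S : Subset p d) g → stabilises p d S g ≡ true → ∀ x → S (g ⟨$⟩ x) ≡ S x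
  stabilises⁻ S g h x = does≡true⇒ (S (g ⟨$⟩ x) ≟ᴮ S x) (all⁻ h (∈-allV x))

  stabilises-∘ᴬ : ∀ (S : Subset p d) g h → stabilises p d S g ≡ true → stabilises p d S h ≡ true →
                  stabilises p d S (g ∘ᴬ h) ≡ true
  stabilises-∘ᴬ S g h Sg Sh = stabilises⁺ S (g ∘ᴬ h) λ x →
    trans (cong S (⟨$⟩-∘ᴬ g h x)) (trans (stabilises⁻ S g Sg (h ⟨$⟩ x)) (stabilises⁻ S h Sh x))

  module _ (g : Aff p d) (inv : Invertible p d (proj₁ g)) (S : Subset p d) where

    stabilises⇒img≡ : stabilises p d S g ≡ true → ∀ y → img p d g S y ≡ S y
    stabilises⇒img≡ st y = true⇔true⇒≡
      (λ q → let (x , Sx , gx≡y) = img⁻ g S y q in trans (cong S (sym gx≡y)) (trans (stabilises⁻ S g st x) Sx))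
      (λ Sy → img⁺ g S (trans (sym (stabilises⁻ S g st g⁻¹y)) (trans (cong S (⟨$⟩-inverseʳ g inv y)) Sy))
                       (⟨$⟩-inverseʳ g inv y))
      where g⁻¹y = inverse g inv ⟨$⟩ y

    img≡⇒stabilises : (∀ y → img p d g S y ≡ S y) → stabilises p d S g ≡ true
    img≡⇒stabilises gS≡S = stabilises⁺ S g λ x → true⇔true⇒≡
      (λ Sgx → let (x′ , Sx′ , gx′≡gx) = img⁻ g S (g ⟨$⟩ x) (trans (gS≡S (g ⟨$⟩ x)) Sgx) in
               subst (λ z → S z ≡ true) (injective gx′≡gx) Sx′)
      (λ Sx → trans (sym (gS≡S (g ⟨$⟩ x))) (img⁺ g S Sx refl))
      where
      injective : ∀ {x x′} → g ⟨$⟩ x′ ≡ g ⟨$⟩ x → x′ ≡ x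
      injective {x} {x′} e =
        trans (sym (⟨$⟩-inverseˡ g inv x′)) (trans (cong (inverse g inv ⟨$⟩_) e) (⟨$⟩-inverseˡ g inv x))

  agreeOn : List (V p d) → Subset p d → Subset p d → Bool
  agreeOn xs S C = all (λ z → does (S z ≟ᴮ C z)) xs

  infix 4 _≐ᵇ_

  _≐ᵇ_ : Subset p d → Subset p d → Bool
  _≐ᵇ_ = agreeOn (allV p d)

  ≐ᵇ⁺ : ∀ {S C : Subset p d} → (∀ z → S z ≡ C z) → (S ≐ᵇ C) ≡ true
  ≐ᵇ⁺ {S} S≗C =
    all⁺ (allV p d) (λ z → trans (cong (λ b → does (S z ≟ᴮ b)) (sym (S≗C z))) (dec-true (S z ≟ᴮ S z) refl))

  ≐ᵇ⁻ : ∀ {S C : Subset p d} → (S ≐ᵇ C) ≡ true → ∀ z → S z ≡ C z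
  ≐ᵇ⁻ {S} {C} h z = does≡true⇒ (S z ≟ᴮ C z) (all⁻ h (∈-allV z))

  private
    agreeOn-upd : ∀ {x xs} (S f : Subset p d) b → All (x ≢_) xs → agreeOn xs S (upd p d f x b) ≡ agreeOn xs S f
    agreeOn-upd S f b [] = refl
    agreeOn-upd {x} S f b (_∷_ {x = y} x≢y x∉xs) =
      cong₂ _∧_ (cong (λ t → does (S y ≟ᴮ t)) unchanged) (agreeOn-upd S f b x∉xs)
      where
      unchanged : upd p d f x b y ≡ f y
      unchanged rewrite dec-false (_≟V_ p d y x) (λ y≡x → x≢y (sym y≡x)) = refl

    upd-here : ∀ {x} (f : Subset p d) b → upd p d f x b x ≡ b
    upd-here {x} f b rewrite dec-true (_≟V_ p d x x) refl = refl

    split : ∀ a e → ⟦ does (a ≟ᴮ true) ∧ e ⟧ + (⟦ does (a ≟ᴮ false) ∧ e ⟧ + 0) ≡ ⟦ e ⟧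
    split true e = ℕ.+-identityʳ ⟦ e ⟧
    split false e = ℕ.+-identityʳ ⟦ e ⟧

  subsetsOf-enumerates : ∀ xs → Unique xs → ∀ S → ∑[ C ∈ subsetsOf p d xs ] ⟦ agreeOn xs S C ⟧ ≡ 1
  subsetsOf-enumerates [] [] S = refl
  subsetsOf-enumerates (x ∷ xs) (x∉xs ∷ unique) S = begin
    ∑ (concatMap (λ f → extend f true ∷ extend f false ∷ []) (subsetsOf p d xs)) (λ C → ⟦ agreeOn (x ∷ xs) S C ⟧)
      ≡⟨ ∑-concatMap (subsetsOf p d xs) _ _ ⟩
    ∑[ f ∈ subsetsOf p d xs ] (⟦ agreeOn (x ∷ xs) S (extend f true) ⟧ + (⟦ agreeOn (x ∷ xs) S (extend f false) ⟧ + 0))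
      ≡⟨ ∑-cong (subsetsOf p d xs) (λ f → trans (cong₂ (λ t u → ⟦ t ⟧ + (⟦ u ⟧ + 0)) (agreeOn-cons f true) (agreeOn-cons f false))
                                               (split (S x) _)) ⟩
    ∑[ f ∈ subsetsOf p d xs ] ⟦ agreeOn xs S f ⟧
      ≡⟨ subsetsOf-enumerates xs unique S ⟩
    1 ∎
    where
    open ≡-Reasoning
    extend : Subset p d → Bool → Subset p d
    extend f b = upd p d f x b
    agreeOn-cons : ∀ f b → agreeOn (x ∷ xs) S (extend f b) ≡ does (S x ≟ᴮ b) ∧ agreeOn xs S f
    agreeOn-cons f b = cong₂ (λ t u → does (S x ≟ᴮ t) ∧ u) (upd-here f b) (agreeOn-upd S f b x∉xs)

  allSubsets-enumerates : ∀ S → ∑[ C ∈ allSubsets p d ] ⟦ S ≐ᵇ C ⟧ ≡ 1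
  allSubsets-enumerates = subsetsOf-enumerates (allV p d) (Enumeration.enumerates⇒unique (_≟V_ p d) allV-enumerates)

module Subgroups (p : ℕ) .{{_ : NonZero p}} (d : ℕ) where

  open import Defs
  open Counting
  open import Data.Bool using (Bool; true; false; _∧_)
  open import Data.Bool.ListAction using (any)
  import Data.Bool.Properties as Boolₚ
  open import Algebra.Bundles using (CommutativeMonoid)
  open import Algebra.Properties.CommutativeSemigroup (CommutativeMonoid.commutativeSemigroup Boolₚ.∧-commutativeMonoid)
    using () renaming (x∙yz≈y∙xz to ∧-x∙yz≈y∙xz)
  open import Data.List using (length)
  open import Data.Nat using (_*_; _^_)
  open import Data.Nat.Properties using (*-identityˡ; *-comm)
  open import Data.Product using (_,_; proj₁; proj₂; _×_; ∃-syntax)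
  open import Relation.Nullary using (does; contradiction)
  open import Relation.Nullary.Decidable using (dec-true)
  open import Relation.Binary.PropositionalEquality

  open AffineGroup p d

  #_ : (Aff p d → Bool) → ℕ
  # P = count p d P (allAff p d)

  #≡∑∑ : ∀ P → # P ≡ ∑[ A ∈ allMat ] ∑[ b ∈ allV p d ] ⟦ P (A , b) ⟧
  #≡∑∑ P = trans (length-filterᵇ P (allAff p d)) (∑-cartesianProduct allMat (allV p d) _)

  #-fixesZero : ∀ (P : Aff p d → Bool) → # (λ g → P g ∧ fixesZero p d g) ≡ ∑[ A ∈ allMat ] ⟦ P (A , 0ᵛ) ⟧
  #-fixesZero P = begin
    # (λ g → P g ∧ fixesZero p d g)
      ≡⟨ #≡∑∑ _ ⟩
    ∑[ A ∈ allMat ] ∑[ b ∈ allV p d ] ⟦ P (A , b) ∧ does (_≟V_ p d b 0ᵛ) ⟧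
      ≡⟨ ∑-cong allMat (λ A → ∑-cong (allV p d) (λ b → at-zero A b)) ⟩
    ∑[ A ∈ allMat ] ∑[ b ∈ allV p d ] (⟦ does (_≟V_ p d b 0ᵛ) ⟧ * ⟦ P (A , b) ⟧)
      ≡⟨ ∑-cong allMat (λ A → ∑-δ allV-enumerates 0ᵛ (λ b → ⟦ P (A , b) ⟧)) ⟩
    ∑[ A ∈ allMat ] ⟦ P (A , 0ᵛ) ⟧ ∎
    where
    open ≡-Reasoning
    open Enumeration (_≟V_ p d) using (∑-δ)
    at-zero : ∀ A b → ⟦ P (A , b) ∧ does (_≟V_ p d b 0ᵛ) ⟧ ≡ ⟦ does (_≟V_ p d b 0ᵛ) ⟧ * ⟦ P (A , b) ⟧
    at-zero A b = trans (⟦∧⟧ (P (A , b)) _) (*-comm ⟦ P (A , b) ⟧ _)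

  linearPart : Aff p d → Aff p d
  linearPart (A , _) = (A , 0ᵛ)

  linearParts : (Aff p d → Bool) → Aff p d → Bool
  linearParts S g = any (λ b → S (proj₁ g , b)) (allV p d) ∧ fixesZero p d g

  linearParts⁺ : ∀ S {A} b → S (A , b) ≡ true → linearParts S (A , 0ᵛ) ≡ true
  linearParts⁺ S b Sb = ∧-true⁺ (any⁺ (∈-allV b) Sb) (dec-true (_≟V_ p d 0ᵛ 0ᵛ) refl)

  linearParts⁻ : ∀ S A c → linearParts S (A , c) ≡ true → c ≡ 0ᵛ × ∃[ b ] S (A , b) ≡ true
  linearParts⁻ S A c h with ∧-true⁻ h
  ... | ∃b , c≡0 = does≡true⇒ (_≟V_ p d c 0ᵛ) c≡0 , any⁻ (allV p d) ∃b

  linearPart-∘ᴬ : ∀ g h → linearPart (g ∘ᴬ h) ≡ linearPart g ∘ᴬ linearPart h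
  linearPart-∘ᴬ (A , _) (A′ , _) = cong (A ·ᴹ A′ ,_) (sym (trans (+ᵛ-identityʳ _) (·ᵛ-0ᵛ A)))

  linearParts-subgroup : ∀ {S} → AffSubgroup p d S → AffSubgroup p d (linearParts S)
  linearParts-subgroup {S} S-subgroup = record
    { mem-inv = λ { (A , c) h → let (_ , b , Sb) = linearParts⁻ S A c h in mem-inv (A , b) Sb }
    ; mem-id = linearParts⁺ S 0ᵛ mem-id
    ; mem-comp = comp
    }
    where
    open AffSubgroup S-subgroup
    comp : ∀ g h → linearParts S g ≡ true → linearParts S h ≡ true → linearParts S (g ∘ᴬ h) ≡ true
    comp (A , c) (A′ , c′) h h′ with linearParts⁻ S A c h | linearParts⁻ S A′ c′ h′
    ... | refl , b , Sb | refl , b′ , Sb′ =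
      subst (λ g → linearParts S g ≡ true) (linearPart-∘ᴬ (A , b) (A′ , b′))
            (linearParts⁺ S _ (mem-comp (A , b) (A′ , b′) Sb Sb′))

  module SubgroupContainingT (G : Aff p d → Bool) (G-subgroup : AffSubgroup p d G) (T⊆G : ContainsT p d G) where

    open AffSubgroup G-subgroup

    G-translate : ∀ {A b} c → G (A , b) ≡ true → G (A , c) ≡ true
    G-translate {A} {b} c Gb = subst (λ g → G g ≡ true) moved (mem-comp _ _ (T⊆G (-ᵛ b +ᵛ c)) Gb)
      where
      moved : translation (-ᵛ b +ᵛ c) ∘ᴬ (A , b) ≡ (A , c)
      moved = trans (translation-∘ᴬ (-ᵛ b +ᵛ c) A b) (cong (A ,_) (\\-leftDividesˡ b c))

    #G≡v*#G₀ : # G ≡ p ^ d * # (G₀ p d G)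
    #G≡v*#G₀ = begin
      # G
        ≡⟨ #≡∑∑ G ⟩
      ∑[ A ∈ allMat ] ∑[ b ∈ allV p d ] ⟦ G (A , b) ⟧
        ≡⟨ ∑-cong allMat (λ A → ∑-cong (allV p d) (λ b → cong ⟦_⟧ (G-depends-on-linear-part A b))) ⟩
      ∑[ A ∈ allMat ] ∑[ b ∈ allV p d ] ⟦ G (A , 0ᵛ) ⟧
        ≡⟨ ∑-cong allMat (λ A → ∑-const (allV p d) _) ⟩
      ∑[ A ∈ allMat ] (length (allV p d) * ⟦ G (A , 0ᵛ) ⟧)
        ≡⟨ ∑-cong allMat (λ A → cong (_* ⟦ G (A , 0ᵛ) ⟧) length-allV) ⟩
      ∑[ A ∈ allMat ] (p ^ d * ⟦ G (A , 0ᵛ) ⟧)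
        ≡⟨ *-distribˡ-∑ allMat (p ^ d) _ ⟨
      p ^ d * ∑[ A ∈ allMat ] ⟦ G (A , 0ᵛ) ⟧
        ≡⟨ cong (p ^ d *_) (#-fixesZero G) ⟨
      p ^ d * # (G₀ p d G) ∎
      where
      open ≡-Reasoning
      G-depends-on-linear-part : ∀ A b → G (A , b) ≡ G (A , 0ᵛ)
      G-depends-on-linear-part A b = true⇔true⇒≡ (G-translate 0ᵛ) (G-translate b)

    module _ (B : Subset p d) where

      Gᴮ Tᴮ G₀ᴮ : Aff p d → Bool
      Gᴮ = G[_] p d G B
      Tᴮ = T[_] p d G B
      G₀ᴮ = G₀[_] p d G B

      Gᴮ-∘ᴬ : ∀ g h → Gᴮ g ≡ true → Gᴮ h ≡ true → Gᴮ (g ∘ᴬ h) ≡ true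
      Gᴮ-∘ᴬ g h Gg Gh with ∧-true⁻ Gg | ∧-true⁻ Gh
      ... | g∈G , g-stab | h∈G , h-stab = ∧-true⁺ (mem-comp g h g∈G h∈G) (stabilises-∘ᴬ B g h g-stab h-stab)

      Gᴮ-subgroup : AffSubgroup p d (Gᴮ)
      Gᴮ-subgroup = record
        { mem-inv = λ g h → mem-inv g (proj₁ (∧-true⁻ h))
        ; mem-id = ∧-true⁺ mem-id (stabilises⁺ B idᴬ (λ x → cong B (idᴬ-⟨$⟩ x)))
        ; mem-comp = Gᴮ-∘ᴬ
        }

      Gᴮ-coset : ∀ {A b₀} → Gᴮ (A , b₀) ≡ true → ∀ b → Gᴮ (A , b₀ +ᵛ b) ≡ Gᴮ (translation b)
      Gᴮ-coset {A} {b₀} g₀∈Gᴮ b = true⇔true⇒≡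
        (λ h → ∧-true⁺ (T⊆G b) (stabilises⁺ B (translation b) (λ y → translate-stable (proj₂ (∧-true⁻ h)) y)))
        (λ h → subst (λ g → Gᴮ g ≡ true) (translation-∘ᴬ b A b₀) (Gᴮ-∘ᴬ _ _ h g₀∈Gᴮ))
        where
        g₀ = (A , b₀)
        g₀-inv = mem-inv g₀ (proj₁ (∧-true⁻ g₀∈Gᴮ))
        g₀⁻¹ = inverse g₀ g₀-inv
        translate-stable : stabilises p d B (A , b₀ +ᵛ b) ≡ true → ∀ y → B (translation b ⟨$⟩ y) ≡ B y
        translate-stable st y = begin
          B (translation b ⟨$⟩ y)            ≡⟨ cong B (translation-⟨$⟩ b y) ⟩
          B (y +ᵛ b)                         ≡⟨ cong (λ z → B (z +ᵛ b)) (⟨$⟩-inverseʳ g₀ g₀-inv y) ⟨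
          B ((g₀ ⟨$⟩ g₀⁻¹ ⟨$⟩ y) +ᵛ b)       ≡⟨ cong B (+ᵛ-assoc _ b₀ b) ⟩
          B ((A , b₀ +ᵛ b) ⟨$⟩ g₀⁻¹ ⟨$⟩ y)   ≡⟨ stabilises⁻ B _ st (g₀⁻¹ ⟨$⟩ y) ⟩
          B (g₀⁻¹ ⟨$⟩ y)                     ≡⟨ stabilises⁻ B g₀ (proj₂ (∧-true⁻ g₀∈Gᴮ)) (g₀⁻¹ ⟨$⟩ y) ⟨
          B (g₀ ⟨$⟩ g₀⁻¹ ⟨$⟩ y)              ≡⟨ cong B (⟨$⟩-inverseʳ g₀ g₀-inv y) ⟩
          B y                                ∎
          where open ≡-Reasoning

      Hᴮ : Aff p d → Bool
      Hᴮ = linearParts Gᴮ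

      private
        #translations : ℕ
        #translations = ∑[ b ∈ allV p d ] ⟦ Gᴮ (translation b) ⟧

        lifts : Mat p d → Bool
        lifts A = any (λ b → Gᴮ (A , b)) (allV p d)

      #Tᴮ≡ : # Tᴮ ≡ #translations
      #Tᴮ≡ = begin
        # Tᴮ
          ≡⟨ #≡∑∑ Tᴮ ⟩
        ∑[ A ∈ allMat ] ∑[ b ∈ allV p d ] ⟦ Tᴮ (A , b) ⟧
          ≡⟨ ∑-cong allMat (λ A → ∑-cong (allV p d) (λ b → linear-part-is-I A b)) ⟩
        ∑[ A ∈ allMat ] ∑[ b ∈ allV p d ] (⟦ does (_≟M_ p d A I) ⟧ * ⟦ Gᴮ (A , b) ⟧)
          ≡⟨ ∑-cong allMat (λ A → *-distribˡ-∑ (allV p d) ⟦ does (_≟M_ p d A I) ⟧ (λ b → ⟦ Gᴮ (A , b) ⟧)) ⟨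
        ∑[ A ∈ allMat ] (⟦ does (_≟M_ p d A I) ⟧ * ∑[ b ∈ allV p d ] ⟦ Gᴮ (A , b) ⟧)
          ≡⟨ Enumeration.∑-δ (_≟M_ p d) allMat-enumerates I _ ⟩
        #translations ∎
        where
        open ≡-Reasoning
        linear-part-is-I : ∀ A b → ⟦ Tᴮ (A , b) ⟧ ≡ ⟦ does (_≟M_ p d A I) ⟧ * ⟦ Gᴮ (A , b) ⟧
        linear-part-is-I A b =
          trans (cong ⟦_⟧ (∧-x∙yz≈y∙xz (G (A , b)) (does (_≟M_ p d A I)) (stabilises p d B (A , b))))
                (⟦∧⟧ (does (_≟M_ p d A I)) (Gᴮ (A , b)))

      #Hᴮ≡ : # Hᴮ ≡ ∑[ A ∈ allMat ] ⟦ lifts A ⟧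
      #Hᴮ≡ = #-fixesZero (λ g → lifts (proj₁ g))

      fibre-size : ∀ A → ∑[ b ∈ allV p d ] ⟦ Gᴮ (A , b) ⟧ ≡ ⟦ lifts A ⟧ * #translations
      fibre-size A with lifts A in lifts≡
      ... | false = ∑-zero (allV p d) empty
        where
        empty : ∀ b → ⟦ Gᴮ (A , b) ⟧ ≡ 0
        empty b with Gᴮ (A , b) in b∈Gᴮ
        ... | false = refl
        ... | true = contradiction (trans (sym lifts≡) (any⁺ (∈-allV b) b∈Gᴮ)) λ ()
      ... | true with any⁻ (allV p d) lifts≡
      ...   | b₀ , b₀∈Gᴮ = begin
        ∑[ b ∈ allV p d ] ⟦ Gᴮ (A , b) ⟧
          ≡⟨ Enumeration.∑-reindex (_≟V_ p d) allV-enumerates (b₀ +ᵛ_) (-ᵛ b₀ +ᵛ_)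
                                   (\\-leftDividesˡ b₀) (\\-leftDividesʳ b₀) _ ⟩
        ∑[ b ∈ allV p d ] ⟦ Gᴮ (A , b₀ +ᵛ b) ⟧
          ≡⟨ ∑-cong (allV p d) (λ b → cong ⟦_⟧ (Gᴮ-coset b₀∈Gᴮ b)) ⟩
        #translations
          ≡⟨ *-identityˡ #translations ⟨
        1 * #translations ∎
        where open ≡-Reasoning

      #Gᴮ≡#Tᴮ*#Hᴮ : # Gᴮ ≡ # Tᴮ * # Hᴮ
      #Gᴮ≡#Tᴮ*#Hᴮ = begin
        # Gᴮ
          ≡⟨ #≡∑∑ Gᴮ ⟩
        ∑[ A ∈ allMat ] ∑[ b ∈ allV p d ] ⟦ Gᴮ (A , b) ⟧
          ≡⟨ ∑-cong allMat fibre-size ⟩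
        ∑[ A ∈ allMat ] (⟦ lifts A ⟧ * #translations)
          ≡⟨ *-distribʳ-∑ allMat #translations _ ⟨
        ∑[ A ∈ allMat ] ⟦ lifts A ⟧ * #translations
          ≡⟨ *-comm _ #translations ⟩
        #translations * ∑[ A ∈ allMat ] ⟦ lifts A ⟧
          ≡⟨ cong₂ _*_ #Tᴮ≡ #Hᴮ≡ ⟨
        # Tᴮ * # Hᴮ ∎
        where open ≡-Reasoning

      Hᴮ⊆G₀ : ∀ g → Hᴮ g ≡ true → G₀ p d G g ≡ true
      Hᴮ⊆G₀ (A , c) h with ∧-true⁻ h | linearParts⁻ Gᴮ A c h
      ... | _ , c≡0 | _ , b , b∈Gᴮ = ∧-true⁺ (G-translate c (proj₁ (∧-true⁻ b∈Gᴮ))) c≡0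

      Gᴮ/Tᴮ≅Hᴮ : QuotientIso p d Gᴮ Tᴮ Hᴮ
      Gᴮ/Tᴮ≅Hᴮ = linearPart , (into , (λ g h _ _ → linearPart-∘ᴬ g h)) , onto , kernel
        where
        into : ∀ g → Gᴮ g ≡ true → Hᴮ (linearPart g) ≡ true
        into (A , b) g∈Gᴮ = linearParts⁺ Gᴮ b g∈Gᴮ
        onto : ∀ h → Hᴮ h ≡ true → ∃[ g ] (Gᴮ g ≡ true × linearPart g ≡ h)
        onto (A , c) h with linearParts⁻ Gᴮ A c h
        ... | refl , b , b∈Gᴮ = (A , b) , b∈Gᴮ , refl
        kernel : ∀ g → Gᴮ g ≡ true → (linearPart g ≡ idᴬ → Tᴮ g ≡ true) × (Tᴮ g ≡ true → linearPart g ≡ idᴬ)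
        kernel (A , b) g∈Gᴮ with ∧-true⁻ g∈Gᴮ
        ... | g∈G , g-stab =
          (λ A,0≡idᴬ → ∧-true⁺ {G (A , b)} g∈G (∧-true⁺ (dec-true (_≟M_ p d A I) (cong proj₁ A,0≡idᴬ)) g-stab)) ,
          (λ g∈Tᴮ → cong (_, 0ᵛ) (does≡true⇒ (_≟M_ p d A I) (linear-part-is-I g∈Tᴮ)))
          where
          linear-part-is-I : Tᴮ (A , b) ≡ true → does (_≟M_ p d A I) ≡ true
          linear-part-is-I g∈Tᴮ = proj₁ (∧-true⁻ (proj₂ (∧-true⁻ {G (A , b)} g∈Tᴮ)))

      G₀ᴮ↪Hᴮ : Embeds p d G₀ᴮ Hᴮ
      G₀ᴮ↪Hᴮ = (λ g → g) , (into , λ _ _ _ _ → refl) , (λ _ _ _ _ g≡h → g≡h)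
        where
        into : ∀ g → G₀ᴮ g ≡ true → Hᴮ g ≡ true
        into (A , b) h with ∧-true⁻ {G (A , b)} h
        ... | g∈G , rest with ∧-true⁻ {fixesZero p d (A , b)} rest
        ...   | b≡0 , g-stab = ∧-true⁺ (any⁺ (∈-allV b) (∧-true⁺ g∈G g-stab)) b≡0

module DoubleCounting (p : ℕ) .{{_ : NonZero p}} (d : ℕ) where

  open import Defs
  open Counting
  open import Data.Bool using (Bool; true; false; not; _∧_)
  import Data.Bool.Properties as Boolₚ
  open import Data.Nat using (_*_; _^_; _+_; _∸_; _<_; _≤_)
  open import Data.Nat.Properties
    using ( *-identityˡ; *-identityʳ; +-identityʳ; *-comm; *-assoc; *-zeroʳ; *-distribʳ-+; m+n∸m≡n; ≤-antisym
          ; *-commutativeSemigroup; module ≤-Reasoning)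
  open import Algebra.Properties.CommutativeSemigroup *-commutativeSemigroup using (x∙yz≈y∙xz)
  open import Data.Product using (_,_; _×_; ∃-syntax)
  open import Relation.Nullary using (does; yes; no; contradiction; ¬_)
  open import Relation.Binary.PropositionalEquality

  open AffineGroup p d
  open Subgroups p d

  size≡∑ : ∀ (C : Subset p d) → size p d C ≡ ∑[ x ∈ allV p d ] ⟦ C x ⟧
  size≡∑ C = length-filterᵇ C (allV p d)

  distinct : V p d → V p d → ℕ
  distinct x y = ⟦ not (does (_≟V_ p d y x)) ⟧

  orderedPairs : Subset p d → ℕ
  orderedPairs S = ∑[ x ∈ allV p d ] ∑[ y ∈ allV p d ] (distinct x y * ⟦ S x ∧ S y ⟧)

  orderedPairs-size : ∀ (S : Subset p d) m → size p d S ≡ m → orderedPairs S ≡ m * (m ∸ 1)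
  orderedPairs-size S m |S|≡m = begin
    orderedPairs S
      ≡⟨ ∑-cong (allV p d) (λ x → trans (∑-cong (allV p d) (pull-out x)) (sym (*-distribˡ-∑ (allV p d) ⟦ S x ⟧ _))) ⟩
    ∑[ x ∈ allV p d ] (⟦ S x ⟧ * others x)
      ≡⟨ ∑-cong (allV p d) others-of-member ⟩
    ∑[ x ∈ allV p d ] (⟦ S x ⟧ * (m ∸ 1))
      ≡⟨ *-distribʳ-∑ (allV p d) (m ∸ 1) _ ⟨
    ∑[ x ∈ allV p d ] ⟦ S x ⟧ * (m ∸ 1)
      ≡⟨ cong (_* (m ∸ 1)) (trans (sym (size≡∑ S)) |S|≡m) ⟩
    m * (m ∸ 1) ∎
    where
    open ≡-Reasoning
    open Enumeration (_≟V_ p d) using (∑-δ)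
    others : V p d → ℕ
    others x = ∑[ y ∈ allV p d ] (distinct x y * ⟦ S y ⟧)
    pull-out : ∀ x y → distinct x y * ⟦ S x ∧ S y ⟧ ≡ ⟦ S x ⟧ * (distinct x y * ⟦ S y ⟧)
    pull-out x y = trans (cong (distinct x y *_) (⟦∧⟧ (S x) (S y))) (x∙yz≈y∙xz (distinct x y) ⟦ S x ⟧ ⟦ S y ⟧)
    self+others : ∀ x → ⟦ S x ⟧ + others x ≡ m
    self+others x = begin
      ⟦ S x ⟧ + others x
        ≡⟨ cong (_+ others x) (∑-δ allV-enumerates x (λ y → ⟦ S y ⟧)) ⟨
      ∑[ y ∈ allV p d ] (⟦ does (_≟V_ p d y x) ⟧ * ⟦ S y ⟧) + others x
        ≡⟨ ∑-distrib-+ (allV p d) _ _ ⟨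
      ∑[ y ∈ allV p d ] (⟦ does (_≟V_ p d y x) ⟧ * ⟦ S y ⟧ + distinct x y * ⟦ S y ⟧)
        ≡⟨ ∑-cong (allV p d) (λ y → trans (sym (*-distribʳ-+ ⟦ S y ⟧ ⟦ does (_≟V_ p d y x) ⟧ (distinct x y)))
                                          (trans (cong (_* ⟦ S y ⟧) (⟦⟧+⟦not⟧ (does (_≟V_ p d y x)))) (*-identityˡ _))) ⟩
      ∑[ y ∈ allV p d ] ⟦ S y ⟧
        ≡⟨ trans (sym (size≡∑ S)) |S|≡m ⟩
      m ∎
    others-of-member : ∀ x → ⟦ S x ⟧ * others x ≡ ⟦ S x ⟧ * (m ∸ 1)
    others-of-member x with S x | self+others x
    ... | false | _ = refl
    ... | true | 1+others≡m = cong (_+ 0) (trans (sym (m+n∸m≡n 1 (others x))) (cong (_∸ 1) 1+others≡m))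

  module FlagTransitive {k : ℕ} (D : Design2 p d k) (G : Aff p d → Bool) (G-subgroup : AffSubgroup p d G)
                        (aut : IsAutGroup p d D G) (flag-transitive : IsFlagTransitive p d D G)
                        (k>0 : 0 < k) where

    open Design2 D
    open AffSubgroup G-subgroup

    block-nonempty : ∀ C → isBlock C ≡ true → ∃[ x ] C x ≡ true
    block-nonempty C C-block = member (∑-positive (allV p d) (λ x → ⟦ C x ⟧) |C|>0)
      where
      |C|>0 : 0 < ∑[ x ∈ allV p d ] ⟦ C x ⟧
      |C|>0 = subst (0 <_) (trans (sym (blockSize C C-block)) (size≡∑ C)) k>0
      member : ∃[ x ] 0 < ⟦ C x ⟧ → ∃[ x ] C x ≡ true
      member (x , Cx>0) with C x in Cx
      ... | true = x , Cx

    blocks-moved : ∀ S S′ → isBlock S ≡ true → isBlock S′ ≡ true →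
                   ∃[ g ] (G g ≡ true × ∀ z → img p d g S z ≡ S′ z)
    blocks-moved S S′ S-block S′-block with block-nonempty S S-block | block-nonempty S′ S′-block
    ... | x , Sx | y , S′y with flag-transitive x y S S′ S-block Sx S′-block S′y
    ...   | g , g∈G , _ , gS≗S′ = g , g∈G , gS≗S′

    module _ (B : Subset p d) (B-block : isBlock B ≡ true) where

      Gᴮ : Aff p d → Bool
      Gᴮ = G[_] p d G B

      image : Aff p d → Subset p d
      image g = img p d g B

      #transporter : Subset p d → ℕ
      #transporter S = ∑[ g ∈ allAff p d ] ⟦ G g ∧ (image g ≐ᵇ S) ⟧

      #transporter-mono : ∀ {S S′} g₀ → G g₀ ≡ true → (∀ z → img p d g₀ S z ≡ S′ z) →
                          #transporter S ≤ #transporter S′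
      #transporter-mono {S} {S′} g₀ g₀∈G g₀S≗S′ = begin
        #transporter S
          ≡⟨ Enumeration.∑-reindex (_≟A_ p d) allAff-enumerates (g₀⁻¹ ∘ᴬ_) (g₀ ∘ᴬ_)
                                   (∘ᴬ-cancelˡ g₀ g₀-inv) (∘ᴬ-cancelʳ g₀ g₀-inv) _ ⟩
        ∑[ g ∈ allAff p d ] ⟦ G (g₀⁻¹ ∘ᴬ g) ∧ (image (g₀⁻¹ ∘ᴬ g) ≐ᵇ S) ⟧
          ≤⟨ ∑-mono-≤ (allAff p d) (λ g → ⟦⟧-mono (moved g)) ⟩
        #transporter S′ ∎
        where
        open ≤-Reasoning
        g₀-inv = mem-inv g₀ g₀∈G
        g₀⁻¹ = inverse g₀ g₀-inv
        moved : ∀ g → G (g₀⁻¹ ∘ᴬ g) ∧ (image (g₀⁻¹ ∘ᴬ g) ≐ᵇ S) ≡ true → G g ∧ (image g ≐ᵇ S′) ≡ true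
        moved g h with ∧-true⁻ h
        ... | h∈G , hB≐S = subst (λ g′ → G g′ ∧ (image g′ ≐ᵇ S′) ≡ true) (∘ᴬ-cancelʳ g₀ g₀-inv g)
          (∧-true⁺ (mem-comp g₀ _ g₀∈G h∈G) (≐ᵇ⁺ λ z →
            trans (img-∘ᴬ g₀ (g₀⁻¹ ∘ᴬ g) B z) (trans (img-cong g₀ (≐ᵇ⁻ hB≐S) z) (g₀S≗S′ z))))

      #transporter-B : #transporter B ≡ # Gᴮ
      #transporter-B = trans (∑-cong (allAff p d) (λ g → cong ⟦_⟧ (fixes⇔stabilises g)))
                             (sym (length-filterᵇ Gᴮ (allAff p d)))
        where
        fixes⇔stabilises : ∀ g → G g ∧ (image g ≐ᵇ B) ≡ Gᴮ g
        fixes⇔stabilises g with G g in g∈G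
        ... | false = refl
        ... | true = true⇔true⇒≡ (λ gB≐B → img≡⇒stabilises g (mem-inv g g∈G) B (≐ᵇ⁻ gB≐B))
                                 (λ g-stab → ≐ᵇ⁺ (stabilises⇒img≡ g (mem-inv g g∈G) B g-stab))

      #transporter≡ : ∀ C → #transporter C ≡ ⟦ isBlock C ⟧ * # Gᴮ
      #transporter≡ C with isBlock C in C-block
      ... | true with blocks-moved B C B-block C-block | blocks-moved C B C-block B-block
      ...   | g , g∈G , gB≗C | g′ , g′∈G , g′C≗B =
        trans (≤-antisym (#transporter-mono g′ g′∈G g′C≗B) (#transporter-mono g g∈G gB≗C))
              (trans #transporter-B (sym (+-identityʳ _)))
      #transporter≡ C | false = ∑-zero (allAff p d) none
        where
        none : ∀ g → ⟦ G g ∧ (image g ≐ᵇ C) ⟧ ≡ 0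
        none g with G g in g∈G | image g ≐ᵇ C in gB≐C
        ... | false | _ = refl
        ... | true | false = refl
        ... | true | true = contradiction
          (trans (sym C-block) (trans (sym (isBlock-ext _ C (≐ᵇ⁻ gB≐C))) (aut g g∈G B B-block))) λ ()

      #images-through : ∀ x y → ¬ x ≡ y → ∑[ g ∈ allAff p d ] ⟦ G g ∧ (image g x ∧ image g y) ⟧ ≡ 2 * # Gᴮ
      #images-through x y x≢y = begin
        ∑[ g ∈ allAff p d ] ⟦ G g ∧ (image g x ∧ image g y) ⟧
          ≡⟨ ∑-partition (allAff p d) (allSubsets p d) (λ g C → image g ≐ᵇ C) (λ g → allSubsets-enumerates (image g)) _ ⟩
        ∑[ C ∈ allSubsets p d ] ∑[ g ∈ allAff p d ] (⟦ image g ≐ᵇ C ⟧ * ⟦ G g ∧ (image g x ∧ image g y) ⟧)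
          ≡⟨ ∑-cong (allSubsets p d) (λ C → ∑-cong (allAff p d) (via-image C)) ⟩
        ∑[ C ∈ allSubsets p d ] ∑[ g ∈ allAff p d ] (⟦ C x ∧ C y ⟧ * ⟦ G g ∧ (image g ≐ᵇ C) ⟧)
          ≡⟨ ∑-cong (allSubsets p d) (λ C → *-distribˡ-∑ (allAff p d) ⟦ C x ∧ C y ⟧ _) ⟨
        ∑[ C ∈ allSubsets p d ] (⟦ C x ∧ C y ⟧ * #transporter C)
          ≡⟨ ∑-cong (allSubsets p d) (λ C → cong (⟦ C x ∧ C y ⟧ *_) (#transporter≡ C)) ⟩
        ∑[ C ∈ allSubsets p d ] (⟦ C x ∧ C y ⟧ * (⟦ isBlock C ⟧ * # Gᴮ))
          ≡⟨ ∑-cong (allSubsets p d) regroup ⟩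
        ∑[ C ∈ allSubsets p d ] (⟦ isBlock C ∧ (C x ∧ C y) ⟧ * # Gᴮ)
          ≡⟨ *-distribʳ-∑ (allSubsets p d) (# Gᴮ) _ ⟨
        ∑[ C ∈ allSubsets p d ] ⟦ isBlock C ∧ (C x ∧ C y) ⟧ * # Gᴮ
          ≡⟨ cong (_* # Gᴮ) (trans (sym (length-filterᵇ _ (allSubsets p d))) (λ≡2 x y x≢y)) ⟩
        2 * # Gᴮ ∎
        where
        open ≡-Reasoning
        via-image : ∀ C g → ⟦ image g ≐ᵇ C ⟧ * ⟦ G g ∧ (image g x ∧ image g y) ⟧ ≡ ⟦ C x ∧ C y ⟧ * ⟦ G g ∧ (image g ≐ᵇ C) ⟧
        via-image C g with image g ≐ᵇ C in gB≐C
        ... | false = sym (trans (cong (λ b → ⟦ C x ∧ C y ⟧ * ⟦ b ⟧) (Boolₚ.∧-zeroʳ (G g))) (*-zeroʳ ⟦ C x ∧ C y ⟧))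
        ... | true = begin
          1 * ⟦ G g ∧ (image g x ∧ image g y) ⟧
            ≡⟨ *-identityˡ _ ⟩
          ⟦ G g ∧ (image g x ∧ image g y) ⟧
            ≡⟨ cong₂ (λ a b → ⟦ G g ∧ (a ∧ b) ⟧) (≐ᵇ⁻ {image g} gB≐C x) (≐ᵇ⁻ {image g} gB≐C y) ⟩
          ⟦ G g ∧ (C x ∧ C y) ⟧
            ≡⟨ trans (⟦∧⟧ (G g) (C x ∧ C y)) (*-comm ⟦ G g ⟧ _) ⟩
          ⟦ C x ∧ C y ⟧ * ⟦ G g ⟧
            ≡⟨ cong (λ b → ⟦ C x ∧ C y ⟧ * ⟦ b ⟧) (Boolₚ.∧-identityʳ (G g)) ⟨
          ⟦ C x ∧ C y ⟧ * ⟦ G g ∧ true ⟧ ∎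
        regroup : ∀ C → ⟦ C x ∧ C y ⟧ * (⟦ isBlock C ⟧ * # Gᴮ) ≡ ⟦ isBlock C ∧ (C x ∧ C y) ⟧ * # Gᴮ
        regroup C = begin
          ⟦ C x ∧ C y ⟧ * (⟦ isBlock C ⟧ * # Gᴮ)   ≡⟨ x∙yz≈y∙xz ⟦ C x ∧ C y ⟧ ⟦ isBlock C ⟧ (# Gᴮ) ⟩
          ⟦ isBlock C ⟧ * (⟦ C x ∧ C y ⟧ * # Gᴮ)   ≡⟨ *-assoc ⟦ isBlock C ⟧ _ _ ⟨
          ⟦ isBlock C ⟧ * ⟦ C x ∧ C y ⟧ * # Gᴮ     ≡⟨ cong (_* # Gᴮ) (⟦∧⟧ (isBlock C) (C x ∧ C y)) ⟨
          ⟦ isBlock C ∧ (C x ∧ C y) ⟧ * # Gᴮ       ∎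

      private
        triples : ℕ
        triples = ∑[ g ∈ allAff p d ] ∑[ x ∈ allV p d ] ∑[ y ∈ allV p d ] (distinct x y * ⟦ G g ∧ (image g x ∧ image g y) ⟧)

      triples-by-element : triples ≡ # G * (k * (k ∸ 1))
      triples-by-element = begin
        triples                                         ≡⟨ ∑-cong (allAff p d) pairs-in-image ⟩
        ∑[ g ∈ allAff p d ] (⟦ G g ⟧ * (k * (k ∸ 1)))   ≡⟨ *-distribʳ-∑ (allAff p d) (k * (k ∸ 1)) _ ⟨
        ∑[ g ∈ allAff p d ] ⟦ G g ⟧ * (k * (k ∸ 1))     ≡⟨ cong (_* (k * (k ∸ 1))) (length-filterᵇ G (allAff p d)) ⟨
        # G * (k * (k ∸ 1))                             ∎
        where
        open ≡-Reasoning
        pairs-in-image : ∀ g → ∑[ x ∈ allV p d ] ∑[ y ∈ allV p d ] (distinct x y * ⟦ G g ∧ (image g x ∧ image g y) ⟧) ≡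
                               ⟦ G g ⟧ * (k * (k ∸ 1))
        pairs-in-image g with G g in g∈G
        ... | false = ∑-zero (allV p d) (λ x → ∑-zero (allV p d) (λ y → *-zeroʳ (distinct x y)))
        ... | true = trans (orderedPairs-size (image g) k (blockSize _ (aut g g∈G B B-block))) (sym (*-identityˡ _))

      triples-by-pair : triples ≡ (p ^ d * (p ^ d ∸ 1)) * (2 * # Gᴮ)
      triples-by-pair = begin
        triples
          ≡⟨ ∑-comm (allAff p d) (allV p d) _ ⟩
        ∑[ x ∈ allV p d ] ∑[ g ∈ allAff p d ] ∑[ y ∈ allV p d ] (distinct x y * ⟦ G g ∧ (image g x ∧ image g y) ⟧)
          ≡⟨ ∑-cong (allV p d) (λ x → ∑-comm (allAff p d) (allV p d) _) ⟩
        ∑[ x ∈ allV p d ] ∑[ y ∈ allV p d ] ∑[ g ∈ allAff p d ] (distinct x y * ⟦ G g ∧ (image g x ∧ image g y) ⟧)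
          ≡⟨ ∑-cong (allV p d) (λ x → ∑-cong (allV p d) (λ y → sym (*-distribˡ-∑ (allAff p d) (distinct x y) _))) ⟩
        ∑[ x ∈ allV p d ] ∑[ y ∈ allV p d ] (distinct x y * ∑[ g ∈ allAff p d ] ⟦ G g ∧ (image g x ∧ image g y) ⟧)
          ≡⟨ ∑-cong (allV p d) (λ x → ∑-cong (allV p d) (only-distinct x)) ⟩
        ∑[ x ∈ allV p d ] ∑[ y ∈ allV p d ] (distinct x y * (2 * # Gᴮ))
          ≡⟨ ∑-cong (allV p d) (λ x → trans (∑-cong (allV p d) (λ y → cong (_* (2 * # Gᴮ)) (sym (*-identityʳ (distinct x y)))))
                                             (sym (*-distribʳ-∑ (allV p d) _ _))) ⟩
        ∑[ x ∈ allV p d ] (∑[ y ∈ allV p d ] (distinct x y * 1) * (2 * # Gᴮ))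
          ≡⟨ *-distribʳ-∑ (allV p d) _ _ ⟨
        orderedPairs (λ _ → true) * (2 * # Gᴮ)
          ≡⟨ cong (_* (2 * # Gᴮ)) (orderedPairs-size (λ _ → true) (p ^ d) |V|≡v) ⟩
        (p ^ d * (p ^ d ∸ 1)) * (2 * # Gᴮ) ∎
        where
        open ≡-Reasoning
        |V|≡v : size p d (λ _ → true) ≡ p ^ d
        |V|≡v = trans (size≡∑ _) (trans (sym (length≡∑1 (allV p d))) length-allV)
        only-distinct : ∀ x y → distinct x y * ∑[ g ∈ allAff p d ] ⟦ G g ∧ (image g x ∧ image g y) ⟧ ≡
                                distinct x y * (2 * # Gᴮ)
        only-distinct x y with _≟V_ p d y x
        ... | yes _ = refl
        ... | no y≢x = cong (_+ 0) (#images-through x y (λ x≡y → y≢x (sym x≡y)))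

      #G*k[k-1]≡v[v-1]*2#Gᴮ : # G * (k * (k ∸ 1)) ≡ (p ^ d * (p ^ d ∸ 1)) * (2 * # Gᴮ)
      #G*k[k-1]≡v[v-1]*2#Gᴮ = trans (sym triples-by-element) triples-by-pair

open import Defs
open import Data.Nat using (_*_; _∸_; _^_; _<_; s≤s; z≤n)
open import Data.Nat.Properties using (*-cancelˡ-≡; *-assoc; ≤-trans; m^n≢0)
open import Data.Nat.Primality using (Prime)
open import Data.Nat.Divisibility using (_∣_)
open import Data.Nat.Solver using (module +-*-Solver)
open import Data.Bool using (Bool; true)
open import Data.Product using (_×_; _,_; ∃-syntax)
open import Relation.Binary.PropositionalEquality

index-formula : ∀ v t h {g g₀ K} .{{_ : NonZero v}} →
                g ≡ v * g₀ → g * K ≡ (v * (v ∸ 1)) * (2 * (t * h)) → g₀ * K ≡ 2 * t * (v ∸ 1) * h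
index-formula v t h {g} {g₀} {K} g≡vg₀ gK≡ = *-cancelˡ-≡ (g₀ * K) (2 * t * (v ∸ 1) * h) v (begin
  v * (g₀ * K)                   ≡⟨ *-assoc v g₀ K ⟨
  v * g₀ * K                     ≡⟨ cong (_* K) g≡vg₀ ⟨
  g * K                          ≡⟨ gK≡ ⟩
  (v * (v ∸ 1)) * (2 * (t * h))  ≡⟨ solve 4 (λ v v-1 t h → (v :* v-1) :* (con 2 :* (t :* h)) := v :* (con 2 :* t :* v-1 :* h))
                                          refl v (v ∸ 1) t h ⟩
  v * (2 * t * (v ∸ 1) * h)      ∎)
  where
  open ≡-Reasoning
  open +-*-Solver

lemma2p5 : (p : ℕ) .{{_ : NonZero p}} → Prime p → (d k : ℕ) →
    (D : Design2 p d k) →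
    2 < k → k < p ^ d →
    (G : Aff p d → Bool) →
    AffSubgroup p d G → ContainsT p d G →
    IsAutGroup p d D G → IsFlagTransitive p d D G → IsPointPrimitive p d G →
    2 ∣ Design2.rep D →
    (B : Subset p d) → Design2.isBlock D B ≡ true →
    ∃[ H ] (IsSubgroupOf p d H (G₀ p d G) ×
            QuotientIso p d (G[_] p d G B) (T[_] p d G B) H ×
            count p d (G₀ p d G) (allAff p d) * (k * (k ∸ 1)) ≡
              2 * count p d (T[_] p d G B) (allAff p d) * (p ^ d ∸ 1) * count p d H (allAff p d) ×
            Embeds p d (G₀[_] p d G B) H)
lemma2p5 p _ d k D k>2 _ G G-subgroup T⊆G aut flag-transitive _ _ B B-block =
  Hᴮ B , (Hᴮ⊆G₀ B , linearParts-subgroup (Gᴮ-subgroup B)) , Gᴮ/Tᴮ≅Hᴮ B , index , G₀ᴮ↪Hᴮ B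
  where
  open Subgroups p d
  open SubgroupContainingT G G-subgroup T⊆G
  open DoubleCounting.FlagTransitive p d D G G-subgroup aut flag-transitive (≤-trans (s≤s z≤n) k>2)
  index : # G₀ p d G * (k * (k ∸ 1)) ≡ 2 * # Tᴮ B * (p ^ d ∸ 1) * # Hᴮ B
  index = index-formula (p ^ d) (# Tᴮ B) (# Hᴮ B) {{m^n≢0 p d}} #G≡v*#G₀
            (trans (#G*k[k-1]≡v[v-1]*2#Gᴮ B B-block) (cong (λ n → (p ^ d * (p ^ d ∸ 1)) * (2 * n)) (#Gᴮ≡#Tᴮ*#Hᴮ B)))
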